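{- For every $n\geq 1$, the polynomial $qr\,C_{n,213}(p,q,r)$ is symmetric in the variables $p,q,r$. Furthermore, for integers $m,d,k\ge 0$, the number of Stirling permutations in $\mathcal{Q}_n(213)$ with exactly $m$ ascents, $d$ descents and $k$ plateaus equals $$\frac{1}{n}\binom{n}{m+1}\binom{n}{d+1}\binom{n}{k}\quad\text{if } 2n-1=m+d+k,$$ and equals $0$ otherwise. Moreover, $$\sum_{\sigma\in \mathcal{Q}_n(213)}p^{\mathrm{plat}(\sigma)}=\frac{1}{n}\sum_{i=0}^{n-1}\binom{n}{i}\binom{2n}{n-1-i}p^{n-i}.$$
   Context: A Stirling permutation of order $n$ is a permutation $\sigma=\sigma_1\cdots\sigma_{2n}$ of the multiset $\{1,1,2,2,\ldots,n,n\}$ such that, for each $i\in[n]$, every entry between the two occurrences of $i$ is greater than $i$; $\mathcal{Q}_n$ denotes the set of these. For $\sigma\in\mathcal{Q}_n$: $\mathrm{des}(\sigma)=\#\{i: 1\le i\le 2n-1,\ \sigma_i>\sigma_{i+1}\}$, $\mathrm{asc}(\sigma)=\#\{i: 1\le i\le 2n-1,\ \sigma_i<\sigma_{i+1}\}$, $\mathrm{plat}(\sigma)=\#\{i: 1\le i\le 2n-1,\ \sigma_i=\sigma_{i+1}\}$. A Stirling permutation $\sigma\in\mathcal{Q}_n$ contains a pattern $\tau=\tau_1\cdots\tau_k$ if there are indices $1\le i_1<\cdots<i_k\le 2n$ with $\sigma_{i_s}<\sigma_{i_t}$ whenever $\tau_s<\tau_t$ (so for a permutation pattern like $213$, this means a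 subsequence $\sigma_{i_1}\sigma_{i_2}\sigma_{i_3}$ with $\sigma_{i_2}<\sigma_{i_1}<\sigma_{i_3}$); otherwise it avoids $\tau$. $\mathcal{Q}_n(\tau)$ is the set of $\sigma\in\mathcal{Q}_n$ avoiding $\tau$, and $C_{n,\tau}(p,q,r)=\sum_{\sigma\in\mathcal{Q}_n(\tau)}p^{\mathrm{plat}(\sigma)}q^{\mathrm{des}(\sigma)}r^{\mathrm{asc}(\sigma)}$. -}

module Defs where

open import Data.Nat using (ℕ; zero; suc; _+_; _*_; _∸_; _^_; _<_; _≤_)
open import Data.Nat.Properties using (_≟_; _<?_)
open import Data.Bool using (Bool; true; false; if_then_else_)
open import Data.Nat using (_<ᵇ_; _≡ᵇ_)
open import Data.Fin using (Fin; toℕ)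
import Data.Fin as F
import Data.Fin.Properties as FP
open import Data.Nat.ListAction using (sum)
open import Data.List using (List; []; _∷_; length; filter; map; concatMap; lookup; applyUpTo)
open import Data.Product using (_×_; Σ-syntax; ∃)
open import Relation.Nullary using (Dec; ¬_; ¬?)
open import Relation.Nullary.Decidable using (_×-dec_; _→-dec_)
open import Relation.Binary.PropositionalEquality using (_≡_)

count : ℕ → List ℕ → ℕ
count x σ = length (filter (x ≟_) σ)

TwiceEach : ℕ → List ℕ → Set
TwiceEach n σ = ∀ (i : Fin n) → count (suc (toℕ i)) σ ≡ 2

StirlingCond : List ℕ → Set
StirlingCond σ = ∀ (a b c : Fin (length σ)) → a F.< b → b F.< c →
  lookup σ a ≡ lookup σ c → lookup σ a < lookup σ b

Contains213 : List ℕ → Set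
Contains213 σ = Σ[ a ∈ Fin (length σ) ] Σ[ b ∈ Fin (length σ) ] Σ[ c ∈ Fin (length σ) ]
  (a F.< b × b F.< c × lookup σ b < lookup σ a × lookup σ a < lookup σ c)

Avoids213 : List ℕ → Set
Avoids213 σ = ¬ Contains213 σ

-- σ ∈ 𝒬ₙ(213), for σ a list of length 2n with entries in [n]
InQ213 : ℕ → List ℕ → Set
InQ213 n σ = TwiceEach n σ × StirlingCond σ × Avoids213 σ

twiceEach? : ∀ n σ → Dec (TwiceEach n σ)
twiceEach? n σ = FP.all? (λ i → count (suc (toℕ i)) σ ≟ 2)

stirlingCond? : ∀ σ → Dec (StirlingCond σ)
stirlingCond? σ = FP.all? λ a → FP.all? λ b → FP.all? λ c →
  (a FP.<? b) →-dec (b FP.<? c) →-dec (lookup σ a ≟ lookup σ c) →-dec (lookup σ a <? lookup σ b)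

contains213? : ∀ σ → Dec (Contains213 σ)
contains213? σ = FP.any? λ a → FP.any? λ b → FP.any? λ c →
  (a FP.<? b) ×-dec (b FP.<? c) ×-dec (lookup σ b <? lookup σ a) ×-dec (lookup σ a <? lookup σ c)

inQ213? : ∀ n σ → Dec (InQ213 n σ)
inQ213? n σ = twiceEach? n σ ×-dec stirlingCond? σ ×-dec ¬? (contains213? σ)

words : ℕ → ℕ → List (List ℕ)
words n zero = [] ∷ []
words n (suc L) = concatMap (λ x → map (x ∷_) (words n L)) (applyUpTo suc n)

-- the finite set 𝒬ₙ(213), as a (duplicate-free) list
Q213 : ℕ → List (List ℕ)
Q213 n = filter (inQ213? n) (words n (2 * n))

countAdj : (ℕ → ℕ → Bool) → List ℕ → ℕ
countAdj R [] = 0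
countAdj R (x ∷ []) = 0
countAdj R (x ∷ y ∷ σ) = (if R x y then 1 else 0) + countAdj R (y ∷ σ)

des asc plat : List ℕ → ℕ
des  = countAdj (λ x y → y <ᵇ x)
asc  = countAdj (λ x y → x <ᵇ y)
plat = countAdj (λ x y → x ≡ᵇ y)

-- C_{n,213}(p,q,r), evaluated at natural numbers p q r
C213 : ℕ → ℕ → ℕ → ℕ → ℕ
C213 n p q r = sum (map (λ σ → p ^ plat σ * q ^ des σ * r ^ asc σ) (Q213 n))

N213 : ℕ → ℕ → ℕ → ℕ → ℕ
N213 n m d k = length (filter (λ σ → (asc σ ≟ m) ×-dec (des σ ≟ d) ×-dec (plat σ ≟ k)) (Q213 n))

Symmetric3 : (ℕ → ℕ → ℕ → ℕ) → Set
Symmetric3 f = ∀ x y z →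
  (f x y z ≡ f y x z) × (f x y z ≡ f x z y) × (f x y z ≡ f z y x) ×
  (f x y z ≡ f y z x) × (f x y z ≡ f z x y)

-- Removing the two copies of the least entry splits σ ∈ 𝒬ₙ(213) as σ = α 1 β 1 γ, where every entry of α
-- exceeds every entry of β and γ, every entry of β exceeds every entry of γ, and α, β, γ are again
-- 213-avoiding Stirling permutations; recursively, 𝒬ₙ(213) is in bijection with ternary trees on n nodes.
-- If a, b, c count the nodes with a nonempty left, middle and right subtree, then asc = b + c,
-- des = a + b and plat = 1 + a + c = n − b.  Encoding trees by the preorder words of their node kinds
-- (Łukasiewicz words) and removing the first letter yields, by induction on n, the count
--   n · #{forests of r trees with statistics a, b, c} = r · C(n, a) C(n, b) C(n, c)   when r + a + b + c = n,
-- and likewise C(n, b) C(2n, a + c) when a + c is recorded as a single statistic; these give the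
-- distribution of (asc, des, plat) and the plateau polynomial.  Exchanging the middle and right (or the
-- left and right) subtrees permutes (a, b, c), hence the variables of q r C_{n,213}, which is symmetric.
module Submission where

open import Data.Bool using (Bool; true; false; if_then_else_; T)
import Data.Bool as Bool
open import Data.Empty using (⊥-elim)
open import Data.Fin as Fin using (toℕ)
open import Data.Fin.Properties using (toℕ<n; toℕ-fromℕ<)
open import Data.List using (List; []; _∷_; _++_; map; concatMap; cartesianProductWith; cartesianProduct; filter; length; lookup; applyUpTo; upTo)
open import Data.List.Properties using (map-++; map-∘; length-++; ∷-injective; ++-assoc; ++-identityʳ; filter-++; filter-accept; filter-reject)
open import Data.List.Extrema.Nat using (max; max<v⁺; max≤v⁺; ⊥≤max; xs≤max)
open import Data.List.Membership.Propositional using (_∈_)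
open import Data.List.Membership.Propositional.Properties
  using (∈-cartesianProductWith⁺; ∈-cartesianProductWith⁻; ∈-cartesianProduct⁺; ∈-map⁺; ∈-map⁻; ∈-filter⁺; ∈-filter⁻; ∈-applyUpTo⁺; ∈-applyUpTo⁻; ∈-upTo⁺; ∈-upTo⁻)
open import Data.List.Membership.Propositional.Properties.WithK using (unique∧set⇒bag)
open import Data.List.Relation.Binary.BagAndSetEquality using (∼bag⇒↭)
open import Data.List.Relation.Binary.Permutation.Propositional using (_↭_)
import Data.List.Relation.Binary.Permutation.Propositional.Properties as ↭
open import Data.List.Relation.Unary.All as All using (All; []; _∷_)
import Data.List.Relation.Unary.All.Properties as All
open import Data.List.Relation.Unary.AllPairs using (AllPairs; []; _∷_)
import Data.List.Relation.Unary.AllPairs.Properties as AllPairs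
open import Data.List.Relation.Unary.Any using (here; there)
open import Data.List.Relation.Unary.Unique.Propositional using (Unique)
import Data.List.Relation.Unary.Unique.Propositional.Properties as Unique
open import Data.Nat
open import Data.Nat.Combinatorics using (_C_; nCk≡nC[n∸k]; nCk+nC[k+1]≡[n+1]C[k+1])
open import Data.Nat.ListAction using (sum)
open import Data.Nat.ListAction.Properties using (sum-++; sum-↭)
open import Data.Nat.Properties
open import Data.Nat.Tactic.RingSolver using (solve-∀)
open import Data.Product using (_×_; _,_; proj₁; proj₂; Σ)
open import Data.Sum using (_⊎_; inj₁; inj₂)
open import Data.Unit using (⊤; tt)
open import Function.Bundles using (mk⇔)
open import Level using (0ℓ)
open import Relation.Binary.Definitions using (tri<; tri≈; tri>)
open import Relation.Binary.PropositionalEquality using (_≡_; _≢_; refl; sym; trans; cong; cong₂; subst; module ≡-Reasoning)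
open import Relation.Nullary using (¬_; Dec; yes; no; does)
open import Relation.Nullary.Decidable using (_×-dec_)
open import Relation.Unary using (Pred; Decidable)

open import Defs

cong₃ : ∀ {A B C D : Set} (f : A → B → C → D) {x x′ y y′ z z′} → x ≡ x′ → y ≡ y′ → z ≡ z′ → f x y z ≡ f x′ y′ z′
cong₃ f refl refl refl = refl

bool→ℕ : Bool → ℕ
bool→ℕ true  = 1
bool→ℕ false = 0

binom : ℕ → ℕ → ℕ
binom n       zero    = 1
binom zero    (suc k) = 0
binom (suc n) (suc k) = binom n k + binom n (suc k)

binom≡C : ∀ n k → binom n k ≡ n C k
binom≡C n       zero    = refl
binom≡C zero    (suc k) = refl
binom≡C (suc n) (suc k) =
  trans (cong₂ _+_ (binom≡C n k) (binom≡C n (suc k))) (nCk+nC[k+1]≡[n+1]C[k+1] n k)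

binom-1 : ∀ n → binom n 1 ≡ n
binom-1 zero    = refl
binom-1 (suc n) = cong suc (binom-1 n)

binom-> : ∀ {n k} → n < k → binom n k ≡ 0
binom-> {zero}  {suc k} _         = refl
binom-> {suc n} {suc k} (s≤s n<k) = cong₂ _+_ (binom-> n<k) (binom-> (m<n⇒m<1+n n<k))

binom-sym : ∀ {n} x y → x + y ≡ n → binom n x ≡ binom n y
binom-sym x y refl = begin
  binom (x + y) x        ≡⟨ binom≡C (x + y) x ⟩
  (x + y) C x            ≡⟨ nCk≡nC[n∸k] (m≤m+n x y) ⟩
  (x + y) C (x + y ∸ x)  ≡⟨ cong ((x + y) C_) (m+n∸m≡n x y) ⟩
  (x + y) C y            ≡⟨ binom≡C (x + y) y ⟨
  binom (x + y) y        ∎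
  where open ≡-Reasoning

suc-*-binom : ∀ n k → suc k * binom (suc n) (suc k) ≡ suc n * binom n k
suc-*-binom zero    zero    = refl
suc-*-binom zero    (suc k) = *-zeroʳ (suc (suc k))
suc-*-binom (suc n) zero    = trans (+-identityʳ _) (trans (binom-1 (2 + n)) (sym (*-identityʳ (2 + n))))
suc-*-binom (suc n) (suc k) = begin
  (2 + k) * ((X + Y) + Z)                                 ≡⟨ expand k X Y Z ⟩
  (X + Y) + ((1 + k) * X + (1 + k) * Y) + (2 + k) * Z    ≡⟨ cong₂ (λ u v → (X + Y) + u + v)
                                                               (trans (sym (*-distribˡ-+ (1 + k) X Y)) (suc-*-binom n k))
                                                               (suc-*-binom n (suc k)) ⟩
  (X + Y) + (1 + n) * X + (1 + n) * Y                     ≡⟨ collect n X Y ⟩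
  (2 + n) * (X + Y)                                       ∎
  where
  open ≡-Reasoning
  X = binom n k
  Y = binom n (suc k)
  Z = binom (suc n) (2 + k)
  expand : ∀ k X Y Z → (2 + k) * ((X + Y) + Z) ≡ (X + Y) + ((1 + k) * X + (1 + k) * Y) + (2 + k) * Z
  expand = solve-∀
  collect : ∀ n X Y → (X + Y) + (1 + n) * X + (1 + n) * Y ≡ (2 + n) * (X + Y)
  collect = solve-∀

-- shift b F a is F (a − [b]), taken to be 0 when a − [b] is negative (unlike F (a ∸ 1)).
shift : Bool → (ℕ → ℕ) → ℕ → ℕ
shift false F a       = F a
shift true  F zero    = 0
shift true  F (suc a) = F a

shift-cong-at : ∀ b a {F G : ℕ → ℕ} → (∀ x → bool→ℕ b + x ≡ a → F x ≡ G x) → shift b F a ≡ shift b G a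
shift-cong-at false a       F≗G = F≗G a refl
shift-cong-at true  zero    F≗G = refl
shift-cong-at true  (suc a) F≗G = F≗G a refl

shift-cong : ∀ b a {F G : ℕ → ℕ} → (∀ x → F x ≡ G x) → shift b F a ≡ shift b G a
shift-cong b a F≗G = shift-cong-at b a (λ x _ → F≗G x)

shift-0 : ∀ b a → shift b (λ _ → 0) a ≡ 0
shift-0 false a       = refl
shift-0 true  zero    = refl
shift-0 true  (suc a) = refl

binom-pascal : ∀ n a → binom (suc n) a ≡ shift true (binom n) a + binom n a
binom-pascal n zero    = refl
binom-pascal n (suc a) = refl

binom-pascal₂ : ∀ n a →
  binom (2 + n) a ≡ shift true (shift true (binom n)) a + shift true (binom n) a + shift true (binom n) a + binom n a
binom-pascal₂ n zero          = refl
binom-pascal₂ n (suc zero)    = refl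
binom-pascal₂ n (suc (suc a)) = regroup (binom n a) (binom n (suc a)) (binom n (2 + a))
  where
  regroup : ∀ x y z → (x + y) + (y + z) ≡ x + y + y + z
  regroup = solve-∀

shift-binom-pascal : ∀ n a → shift true (binom (suc n)) a ≡ shift true (shift true (binom n)) a + shift true (binom n) a
shift-binom-pascal n zero    = refl
shift-binom-pascal n (suc a) = binom-pascal n a

suc-*-shift-binom : ∀ n a → suc n * shift true (binom n) a ≡ a * binom (suc n) a
suc-*-shift-binom n zero    = *-zeroʳ (suc n)
suc-*-shift-binom n (suc a) = sym (suc-*-binom n a)

module _ {A : Set} where

  sum-map-cong : ∀ {f g : A → ℕ} (xs : List A) → (∀ x → x ∈ xs → f x ≡ g x) → sum (map f xs) ≡ sum (map g xs)
  sum-map-cong []       f≗g = refl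
  sum-map-cong (x ∷ xs) f≗g = cong₂ _+_ (f≗g x (here refl)) (sum-map-cong xs (λ y y∈ → f≗g y (there y∈)))

  sum-map-0 : ∀ {f : A → ℕ} (xs : List A) → (∀ x → x ∈ xs → f x ≡ 0) → sum (map f xs) ≡ 0
  sum-map-0 []       f≗0 = refl
  sum-map-0 (x ∷ xs) f≗0 = cong₂ _+_ (f≗0 x (here refl)) (sum-map-0 xs (λ y y∈ → f≗0 y (there y∈)))

  sum-map-+ : ∀ (f g : A → ℕ) xs → sum (map (λ x → f x + g x) xs) ≡ sum (map f xs) + sum (map g xs)
  sum-map-+ f g []       = refl
  sum-map-+ f g (x ∷ xs) = trans (cong (f x + g x +_) (sum-map-+ f g xs)) (interchange (f x) (g x) _ _)
    where
    interchange : ∀ a b c d → a + b + (c + d) ≡ a + c + (b + d)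
    interchange = solve-∀

  *-distribˡ-sum : ∀ k (f : A → ℕ) xs → k * sum (map f xs) ≡ sum (map (λ x → k * f x) xs)
  *-distribˡ-sum k f []       = *-zeroʳ k
  *-distribˡ-sum k f (x ∷ xs) = trans (*-distribˡ-+ k (f x) _) (cong (k * f x +_) (*-distribˡ-sum k f xs))

  *-distribʳ-sum : ∀ k (f : A → ℕ) xs → sum (map f xs) * k ≡ sum (map (λ x → f x * k) xs)
  *-distribʳ-sum k f xs =
    trans (*-comm _ k) (trans (*-distribˡ-sum k f xs) (sum-map-cong xs (λ x _ → *-comm k (f x))))

  sum-map-↭ : ∀ (f : A → ℕ) {xs ys} → xs ↭ ys → sum (map f xs) ≡ sum (map f ys)
  sum-map-↭ f xs↭ys = sum-↭ (↭.map⁺ f xs↭ys)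

  sum-filter : ∀ {P : Pred A 0ℓ} (P? : Decidable P) (f : A → ℕ) xs →
    sum (map f (filter P? xs)) ≡ sum (map (λ x → if does (P? x) then f x else 0) xs)
  sum-filter P? f []       = refl
  sum-filter P? f (x ∷ xs) with P? x
  ... | yes _ = cong (f x +_) (sum-filter P? f xs)
  ... | no  _ = sum-filter P? f xs

  length-filter-sum : ∀ {P : Pred A 0ℓ} (P? : Decidable P) xs →
    length (filter P? xs) ≡ sum (map (λ x → if does (P? x) then 1 else 0) xs)
  length-filter-sum P? []       = refl
  length-filter-sum P? (x ∷ xs) with P? x
  ... | yes _ = cong suc (length-filter-sum P? xs)
  ... | no  _ = length-filter-sum P? xs

  unique-⇔⇒↭ : ∀ {xs ys : List A} → Unique xs → Unique ys →
    (∀ {x} → x ∈ xs → x ∈ ys) → (∀ {x} → x ∈ ys → x ∈ xs) → xs ↭ ys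
  unique-⇔⇒↭ xs! ys! to from = ∼bag⇒↭ (unique∧set⇒bag xs! ys! (mk⇔ to from))

module _ {A B : Set} where

  sum-map-map : ∀ (g : B → ℕ) (f : A → B) xs → sum (map g (map f xs)) ≡ sum (map (λ x → g (f x)) xs)
  sum-map-map g f xs = cong sum (sym (map-∘ xs))

  sum-map-comm : ∀ (f : A → B → ℕ) xs ys →
    sum (map (λ x → sum (map (f x) ys)) xs) ≡ sum (map (λ y → sum (map (λ x → f x y) xs)) ys)
  sum-map-comm f []       ys = sym (sum-map-0 ys (λ _ _ → refl))
  sum-map-comm f (x ∷ xs) ys =
    trans (cong (sum (map (f x) ys) +_) (sum-map-comm f xs ys))
          (sym (sum-map-+ (f x) (λ y → sum (map (λ x → f x y) xs)) ys))

sum-cartesianProductWith : ∀ {A B C : Set} (g : C → ℕ) (f : A → B → C) xs ys →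
  sum (map g (cartesianProductWith f xs ys)) ≡ sum (map (λ x → sum (map (λ y → g (f x y)) ys)) xs)
sum-cartesianProductWith g f []       ys = refl
sum-cartesianProductWith g f (x ∷ xs) ys = begin
  sum (map g (map (f x) ys ++ cartesianProductWith f xs ys))           ≡⟨ cong sum (map-++ g (map (f x) ys) _) ⟩
  sum (map g (map (f x) ys) ++ map g (cartesianProductWith f xs ys))   ≡⟨ sum-++ (map g (map (f x) ys)) _ ⟩
  sum (map g (map (f x) ys)) + sum (map g (cartesianProductWith f xs ys))
    ≡⟨ cong₂ _+_ (sum-map-map g (f x) ys) (sum-cartesianProductWith g f xs ys) ⟩
  _                                                                     ∎
  where open ≡-Reasoning

tuples : ∀ {A : Set} → List A → ℕ → List (List A)
tuples X zero    = [] ∷ []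
tuples X (suc n) = cartesianProductWith _∷_ X (tuples X n)

module _ {A : Set} (X : List A) where

  sum-tuples-suc : ∀ (f : List A → ℕ) n →
    sum (map f (tuples X (suc n))) ≡ sum (map (λ x → sum (map (λ l → f (x ∷ l)) (tuples X n))) X)
  sum-tuples-suc f n = sum-cartesianProductWith f _∷_ X (tuples X n)

  ∈-tuples⁻ : ∀ n {l} → l ∈ tuples X n → length l ≡ n × All (_∈ X) l
  ∈-tuples⁻ zero    (here refl) = refl , []
  ∈-tuples⁻ (suc n) l∈ with ∈-cartesianProductWith⁻ _∷_ X (tuples X n) l∈
  ... | x , l′ , x∈X , l′∈ , refl = cong suc (proj₁ (∈-tuples⁻ n l′∈)) , x∈X ∷ proj₂ (∈-tuples⁻ n l′∈)

  ∈-tuples⁺ : ∀ {l} → All (_∈ X) l → l ∈ tuples X (length l)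
  ∈-tuples⁺ {[]}    []          = here refl
  ∈-tuples⁺ {x ∷ l} (x∈X ∷ l∈X) = ∈-cartesianProductWith⁺ _∷_ x∈X (∈-tuples⁺ l∈X)

  tuples-unique : Unique X → ∀ n → Unique (tuples X n)
  tuples-unique X! zero    = [] ∷ []
  tuples-unique X! (suc n) = Unique.cartesianProductWith⁺ _∷_ (λ { refl → refl , refl }) X! (tuples-unique X! n)

-- Łukasiewicz words of ternary forests

-- The kind of a node of a ternary tree records which of its left, middle and right subtrees are nonempty.
data Kind : Set where
  kind : (left middle right : Bool) → Kind

kind-injective : ∀ {i j l i′ j′ l′} → kind i j l ≡ kind i′ j′ l′ → i ≡ i′ × j ≡ j′ × l ≡ l′
kind-injective refl = refl , refl , refl

degree : Kind → ℕ
degree (kind i j l) = bool→ℕ i + bool→ℕ j + bool→ℕ l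

-- isForest r κs: κs is the preorder list of node kinds of a forest of r nonempty trees (a Łukasiewicz word).
isForest : ℕ → List Kind → Bool
isForest zero    []       = true
isForest (suc r) []       = false
isForest zero    (κ ∷ κs) = false
isForest (suc r) (κ ∷ κs) = isForest (r + degree κ) κs

hasLeft hasMiddle hasRight : Kind → ℕ
hasLeft   (kind i _ _) = bool→ℕ i
hasMiddle (kind _ j _) = bool→ℕ j
hasRight  (kind _ _ l) = bool→ℕ l

lefts middles rights : List Kind → ℕ
lefts   κs = sum (map hasLeft κs)
middles κs = sum (map hasMiddle κs)
rights  κs = sum (map hasRight κs)

bools : List Bool
bools = false ∷ true ∷ []

allKinds : List Kind
allKinds = cartesianProductWith (λ i jl → kind i (proj₁ jl) (proj₂ jl)) bools (cartesianProduct bools bools)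

kindWords : ℕ → List (List Kind)
kindWords = tuples allKinds

ifEq : ℕ → ℕ → ℕ → ℕ
ifEq x a K = if x ≡ᵇ a then K else 0

ifEq-yes : ∀ x a K → x ≡ a → ifEq x a K ≡ K
ifEq-yes x a K x≡a with x ≡ᵇ a in eq
... | true  = refl
... | false = ⊥-elim (subst T eq (≡⇒≡ᵇ x a x≡a))

ifEq-no : ∀ x a K → x ≢ a → ifEq x a K ≡ 0
ifEq-no x a K x≢a with x ≡ᵇ a in eq
... | true  = ⊥-elim (x≢a (≡ᵇ⇒≡ x a (subst T (sym eq) tt)))
... | false = refl

ifEq-0 : ∀ x a → ifEq x a 0 ≡ 0
ifEq-0 x a with x ≡ᵇ a
... | true  = refl
... | false = refl

ifEq³-0 : ∀ a b c a₀ b₀ c₀ → ifEq a a₀ (ifEq b b₀ (ifEq c c₀ 0)) ≡ 0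
ifEq³-0 a b c a₀ b₀ c₀ = trans (cong (λ u → ifEq a a₀ (ifEq b b₀ u)) (ifEq-0 c c₀)) (trans (cong (ifEq a a₀) (ifEq-0 b b₀)) (ifEq-0 a a₀))

ifEq-+ : ∀ i x a K → ifEq (bool→ℕ i + x) a K ≡ shift i (λ a′ → ifEq x a′ K) a
ifEq-+ false x a       K = refl
ifEq-+ true  x zero    K = refl
ifEq-+ true  x (suc a) K = refl

ifEq-shift : ∀ x a i c (F : ℕ → ℕ) → ifEq x a (shift i F c) ≡ shift i (λ c′ → ifEq x a (F c′)) c
ifEq-shift x a i c F with x ≡ᵇ a
... | true  = refl
... | false = sym (shift-0 i c)

sum-shift : ∀ {A : Set} i (G : ℕ → A → ℕ) a (xs : List A) →
  sum (map (λ x → shift i (λ a′ → G a′ x) a) xs) ≡ shift i (λ a′ → sum (map (G a′) xs)) a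
sum-shift false G a       xs = refl
sum-shift true  G zero    xs = sum-map-0 xs (λ _ _ → refl)
sum-shift true  G (suc a) xs = refl

sum-kindWords-suc≡0 : ∀ n (f : List Kind → ℕ) → (∀ κ κs → f (κ ∷ κs) ≡ 0) → sum (map f (kindWords (suc n))) ≡ 0
sum-kindWords-suc≡0 n f f∷≡0 = trans (sum-tuples-suc allKinds f n)
  (sum-map-0 allKinds (λ κ _ → sum-map-0 (kindWords n) (λ κs _ → f∷≡0 κ κs)))

shift-lift : ∀ (f : ℕ → ℕ) → f 0 ≡ 0 → ∀ b F a → f (shift b F a) ≡ shift b (λ x → f (F x)) a
shift-lift f f0≡0 false F a       = refl
shift-lift f f0≡0 true  F zero    = f0≡0
shift-lift f f0≡0 true  F (suc a) = refl

shift³ : Bool → Bool → Bool → (ℕ → ℕ → ℕ → ℕ) → ℕ → ℕ → ℕ → ℕ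
shift³ i j l F a b c = shift i (λ a′ → shift j (λ b′ → shift l (λ c′ → F a′ b′ c′) c) b) a

shift³-lift : ∀ (f : ℕ → ℕ) → f 0 ≡ 0 → ∀ i j l F a b c →
  f (shift³ i j l F a b c) ≡ shift³ i j l (λ x y z → f (F x y z)) a b c
shift³-lift f f0≡0 i j l F a b c =
  trans (shift-lift f f0≡0 i _ a) (shift-cong i a (λ x →
    trans (shift-lift f f0≡0 j _ b) (shift-cong j b (λ y → shift-lift f f0≡0 l _ c))))

shift³-cong-at : ∀ i j l a b c {F G : ℕ → ℕ → ℕ → ℕ} →
  (∀ x y z → bool→ℕ i + x ≡ a → bool→ℕ j + y ≡ b → bool→ℕ l + z ≡ c → F x y z ≡ G x y z) →
  shift³ i j l F a b c ≡ shift³ i j l G a b c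
shift³-cong-at i j l a b c F≗G =
  shift-cong-at i a (λ x ex → shift-cong-at j b (λ y ey → shift-cong-at l c (λ z ez → F≗G x y z ex ey ez)))

shift³-product : ∀ i j l (F G H : ℕ → ℕ) a b c →
  shift³ i j l (λ x y z → F x * G y * H z) a b c ≡ shift i F a * shift j G b * shift l H c
shift³-product i j l F G H a b c = sym (begin
  shift i F a * sG * sH                                             ≡⟨ shift-lift (λ u → u * sG * sH) refl i F a ⟩
  shift i (λ x → F x * sG * sH) a                                   ≡⟨ shift-cong i a (λ x →
                                                                         shift-lift (λ u → F x * u * sH) (cong (_* sH) (*-zeroʳ (F x))) j G b) ⟩
  shift i (λ x → shift j (λ y → F x * G y * sH) b) a                ≡⟨ shift-cong i a (λ x → shift-cong j b (λ y →
                                                                         shift-lift (λ u → F x * G y * u) (*-zeroʳ (F x * G y)) l H c)) ⟩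
  shift³ i j l (λ x y z → F x * G y * H z) a b c                    ∎)
  where
  open ≡-Reasoning
  sG = shift j G b
  sH = shift l H c

sum-shift³ : ∀ {A : Set} i j l (G : A → ℕ → ℕ → ℕ → ℕ) a b c (xs : List A) →
  sum (map (λ x → shift³ i j l (G x) a b c) xs) ≡ shift³ i j l (λ a′ b′ c′ → sum (map (λ x → G x a′ b′ c′) xs)) a b c
sum-shift³ i j l G a b c xs =
  trans (sum-shift i _ a xs) (shift-cong i a (λ x →
    trans (sum-shift j _ b xs) (shift-cong j b (λ y → sum-shift l _ c xs))))

forestIndicator : ℕ → ℕ → ℕ → ℕ → List Kind → ℕ
forestIndicator r a b c κs = ifEq (lefts κs) a (ifEq (middles κs) b (ifEq (rights κs) c (bool→ℕ (isForest r κs))))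

forestCount : ℕ → ℕ → ℕ → ℕ → ℕ → ℕ
forestCount r n a b c = sum (map (forestIndicator r a b c) (kindWords n))

forestIndicator-∷ : ∀ r a b c i j l κs → forestIndicator (suc r) a b c (kind i j l ∷ κs) ≡
  shift³ i j l (λ a′ b′ c′ → forestIndicator (r + degree (kind i j l)) a′ b′ c′ κs) a b c
forestIndicator-∷ r a b c i j l κs = begin
  ifEq (bool→ℕ i + x) a (ifEq (bool→ℕ j + y) b (ifEq (bool→ℕ l + z) c W))
    ≡⟨ cong (λ u → ifEq (bool→ℕ i + x) a (ifEq (bool→ℕ j + y) b u)) (ifEq-+ l z c W) ⟩
  ifEq (bool→ℕ i + x) a (ifEq (bool→ℕ j + y) b (shift l (λ c′ → ifEq z c′ W) c))
    ≡⟨ cong (ifEq (bool→ℕ i + x) a) (trans (ifEq-+ j y b _) (shift-cong j b (λ b′ → ifEq-shift y b′ l c _))) ⟩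
  ifEq (bool→ℕ i + x) a (shift j (λ b′ → shift l (λ c′ → ifEq y b′ (ifEq z c′ W)) c) b)
    ≡⟨ ifEq-+ i x a _ ⟩
  shift i (λ a′ → ifEq x a′ (shift j (λ b′ → shift l (λ c′ → ifEq y b′ (ifEq z c′ W)) c) b)) a
    ≡⟨ shift-cong i a (λ a′ → trans (ifEq-shift x a′ j b _) (shift-cong j b (λ b′ → ifEq-shift x a′ l c _))) ⟩
  shift³ i j l (λ a′ b′ c′ → forestIndicator (r + degree (kind i j l)) a′ b′ c′ κs) a b c ∎
  where
  open ≡-Reasoning
  x = lefts κs
  y = middles κs
  z = rights κs
  W = bool→ℕ (isForest (r + degree (kind i j l)) κs)

forestCount-afterRoot : ℕ → ℕ → ℕ → ℕ → ℕ → Kind → ℕ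
forestCount-afterRoot r n a b c (kind i j l) = shift³ i j l (forestCount (r + degree (kind i j l)) n) a b c

forestCount-suc : ∀ r n a b c → forestCount (suc r) (suc n) a b c ≡ sum (map (forestCount-afterRoot r n a b c) allKinds)
forestCount-suc r n a b c = trans (sum-tuples-suc allKinds (forestIndicator (suc r) a b c) n) (sum-map-cong allKinds (λ κ _ → root κ))
  where
  root : ∀ κ → sum (map (λ κs → forestIndicator (suc r) a b c (κ ∷ κs)) (kindWords n)) ≡ forestCount-afterRoot r n a b c κ
  root (kind i j l) =
    trans (sum-map-cong (kindWords n) (λ κs _ → forestIndicator-∷ r a b c i j l κs)) (sum-shift³ i j l _ a b c (kindWords n))

forestCount-no-trees : ∀ n a b c → forestCount 0 (suc n) a b c ≡ 0
forestCount-no-trees n a b c = sum-kindWords-suc≡0 n (forestIndicator 0 a b c) (λ κ κs →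
  ifEq³-0 (lefts (κ ∷ κs)) (middles (κ ∷ κs)) (rights (κ ∷ κs)) a b c)

private
  *-comm-middle : ∀ m n k → m * (n * k) ≡ n * (m * k)
  *-comm-middle = solve-∀

  factor : ∀ N r P → (N * r + N) * P ≡ N * (suc r * P)
  factor = solve-∀

ForestFormula : ℕ → Set
ForestFormula n = ∀ r a b c → r + a + b + c ≡ n → n * forestCount r n a b c ≡ r * (binom n a * binom n b * binom n c)

kindBinom : ℕ → ℕ → ℕ → ℕ → Kind → ℕ
kindBinom N a b c (kind i j l) = shift i (binom N) a * shift j (binom N) b * shift l (binom N) c

forestCount-afterRoot-formula : ∀ {N} → ForestFormula N → ∀ r a b c → r + a + b + c ≡ N → ∀ κ →
  N * forestCount-afterRoot r N a b c κ ≡ (r + degree κ) * kindBinom N a b c κ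
forestCount-afterRoot-formula {N} IH r a b c h (kind i j l) = begin
  N * shift³ i j l (forestCount (r + d) N) a b c
    ≡⟨ shift³-lift (N *_) (*-zeroʳ N) i j l _ a b c ⟩
  shift³ i j l (λ x y z → N * forestCount (r + d) N x y z) a b c
    ≡⟨ shift³-cong-at i j l a b c (λ x y z ex ey ez → IH (r + d) x y z (subtree-sizes x y z ex ey ez)) ⟩
  shift³ i j l (λ x y z → (r + d) * (binom N x * binom N y * binom N z)) a b c
    ≡⟨ shift³-lift ((r + d) *_) (*-zeroʳ (r + d)) i j l _ a b c ⟨
  (r + d) * shift³ i j l (λ x y z → binom N x * binom N y * binom N z) a b c
    ≡⟨ cong ((r + d) *_) (shift³-product i j l (binom N) (binom N) (binom N) a b c) ⟩
  (r + d) * kindBinom N a b c (kind i j l) ∎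
  where
  open ≡-Reasoning
  d = degree (kind i j l)
  regroup : ∀ r i j l x y z → r + (i + x) + (j + y) + (l + z) ≡ r + (i + j + l) + x + y + z
  regroup = solve-∀
  subtree-sizes : ∀ x y z → bool→ℕ i + x ≡ a → bool→ℕ j + y ≡ b → bool→ℕ l + z ≡ c → r + d + x + y + z ≡ N
  subtree-sizes x y z refl refl refl = trans (sym (regroup r (bool→ℕ i) (bool→ℕ j) (bool→ℕ l) x y z)) h

-- Writing r + degree κ as r plus one for each nonempty child, the sum over the eight kinds factors; the
-- absorption identity (N + 1) C(N, a − 1) = a C(N + 1, a) then turns the coefficient N + 1 into r + a + b + c = N.
forestFormula-step-identity : ∀ N r a b c → r + a + b + c ≡ N →
  suc N * sum (map (λ κ → (r + degree κ) * kindBinom N a b c κ) allKinds) ≡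
  N * (suc r * (binom (suc N) a * binom (suc N) b * binom (suc N) c))
forestFormula-step-identity N r a b c h = begin
  suc N * ((r + 0) * (X₀ * Y₀ * Z₀) + ((r + 1) * (X₀ * Y₀ * Z₁) + ((r + 1) * (X₀ * Y₁ * Z₀) +
    ((r + 2) * (X₀ * Y₁ * Z₁) + ((r + 1) * (X₁ * Y₀ * Z₀) + ((r + 2) * (X₁ * Y₀ * Z₁) +
    ((r + 2) * (X₁ * Y₁ * Z₀) + ((r + 3) * (X₁ * Y₁ * Z₁) + 0))))))))
    ≡⟨ expand N r X₀ X₁ Y₀ Y₁ Z₀ Z₁ ⟩
  suc N * r * (X * Y * Z) + (suc N * X₁) * Y * Z + X * (suc N * Y₁) * Z + X * Y * (suc N * Z₁)
    ≡⟨ cong₃ (λ u v w → suc N * r * (X * Y * Z) + u * Y * Z + X * v * Z + X * Y * w) (absorb a) (absorb b) (absorb c) ⟩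
  suc N * r * (X * Y * Z) + (a * X) * Y * Z + X * (b * Y) * Z + X * Y * (c * Z)
    ≡⟨ collect N r a b c X Y Z ⟩
  (N * r + (r + a + b + c)) * (X * Y * Z)
    ≡⟨ cong (λ u → (N * r + u) * (X * Y * Z)) h ⟩
  (N * r + N) * (X * Y * Z)
    ≡⟨ factor N r (X * Y * Z) ⟩
  N * (suc r * (X * Y * Z))
    ≡⟨ cong (λ u → N * (suc r * u)) pascal³ ⟨
  N * (suc r * (binom (suc N) a * binom (suc N) b * binom (suc N) c)) ∎
  where
  open ≡-Reasoning
  X₀ = binom N a
  X₁ = shift true (binom N) a
  Y₀ = binom N b
  Y₁ = shift true (binom N) b
  Z₀ = binom N c
  Z₁ = shift true (binom N) c
  X = X₁ + X₀
  Y = Y₁ + Y₀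
  Z = Z₁ + Z₀
  pascal³ : binom (suc N) a * binom (suc N) b * binom (suc N) c ≡ X * Y * Z
  pascal³ = cong₂ _*_ (cong₂ _*_ (binom-pascal N a) (binom-pascal N b)) (binom-pascal N c)
  absorb : ∀ x → suc N * shift true (binom N) x ≡ x * (shift true (binom N) x + binom N x)
  absorb x = trans (suc-*-shift-binom N x) (cong (x *_) (binom-pascal N x))
  expand : ∀ N r X₀ X₁ Y₀ Y₁ Z₀ Z₁ →
    suc N * ((r + 0) * (X₀ * Y₀ * Z₀) + ((r + 1) * (X₀ * Y₀ * Z₁) + ((r + 1) * (X₀ * Y₁ * Z₀) +
      ((r + 2) * (X₀ * Y₁ * Z₁) + ((r + 1) * (X₁ * Y₀ * Z₀) + ((r + 2) * (X₁ * Y₀ * Z₁) +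
      ((r + 2) * (X₁ * Y₁ * Z₀) + ((r + 3) * (X₁ * Y₁ * Z₁) + 0))))))))
    ≡ suc N * r * ((X₁ + X₀) * (Y₁ + Y₀) * (Z₁ + Z₀)) + (suc N * X₁) * (Y₁ + Y₀) * (Z₁ + Z₀)
      + (X₁ + X₀) * (suc N * Y₁) * (Z₁ + Z₀) + (X₁ + X₀) * (Y₁ + Y₀) * (suc N * Z₁)
  expand = solve-∀
  collect : ∀ N r a b c X Y Z → suc N * r * (X * Y * Z) + (a * X) * Y * Z + X * (b * Y) * Z + X * Y * (c * Z)
    ≡ (N * r + (r + a + b + c)) * (X * Y * Z)
  collect = solve-∀

-- The induction hypothesis speaks about N · forestCount at size N, so the goal is multiplied by N ≠ 0 first.
forestFormula-step : ∀ {N} .{{_ : NonZero N}} → ForestFormula N → ∀ r a b c → suc r + a + b + c ≡ suc N →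
  suc N * forestCount (suc r) (suc N) a b c ≡ suc r * (binom (suc N) a * binom (suc N) b * binom (suc N) c)
forestFormula-step {N} IH r a b c h = *-cancelˡ-≡ _ _ N (begin
  N * (suc N * forestCount (suc r) (suc N) a b c)                      ≡⟨ *-comm-middle N (suc N) _ ⟩
  suc N * (N * forestCount (suc r) (suc N) a b c)                      ≡⟨ cong (λ u → suc N * (N * u)) (forestCount-suc r N a b c) ⟩
  suc N * (N * sum (map (forestCount-afterRoot r N a b c) allKinds))   ≡⟨ cong (suc N *_) (*-distribˡ-sum N (forestCount-afterRoot r N a b c) allKinds) ⟩
  suc N * sum (map (λ κ → N * forestCount-afterRoot r N a b c κ) allKinds)
    ≡⟨ cong (suc N *_) (sum-map-cong allKinds (λ κ _ → forestCount-afterRoot-formula IH r a b c h′ κ)) ⟩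
  suc N * sum (map (λ κ → (r + degree κ) * kindBinom N a b c κ) allKinds)
    ≡⟨ forestFormula-step-identity N r a b c h′ ⟩
  N * (suc r * (binom (suc N) a * binom (suc N) b * binom (suc N) c)) ∎)
  where
  open ≡-Reasoning
  h′ : r + a + b + c ≡ N
  h′ = suc-injective h

forestFormula : ∀ n → ForestFormula n
forestFormula zero          r             a       b       c       h rewrite m+n≡0⇒m≡0 r (m+n≡0⇒m≡0 (r + a) (m+n≡0⇒m≡0 (r + a + b) h)) = refl
forestFormula (suc n)       zero          a       b       c       h = trans (cong (suc n *_) (forestCount-no-trees n a b c)) (*-zeroʳ (suc n))
forestFormula (suc zero)    (suc zero)    zero    zero    zero    refl = refl
forestFormula (suc zero)    (suc (suc r)) a       b       c       ()
forestFormula (suc zero)    (suc zero)    (suc a) b       c       ()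
forestFormula (suc zero)    (suc zero)    zero    (suc b) c       ()
forestFormula (suc zero)    (suc zero)    zero    zero    (suc c) ()
forestFormula (suc (suc n)) (suc r)       a       b       c       h = forestFormula-step (forestFormula (suc n)) r a b c h

double : ℕ → ℕ
double zero    = zero
double (suc n) = suc (suc (double n))

double≡2* : ∀ n → double n ≡ 2 * n
double≡2* zero    = refl
double≡2* (suc n) = cong suc (trans (cong suc (double≡2* n)) (sym (+-suc n (n + 0))))

shift₂ : Bool → Bool → Bool → (ℕ → ℕ → ℕ) → ℕ → ℕ → ℕ
shift₂ j i l F b e = shift j (λ b′ → shift i (λ e′ → shift l (λ e″ → F b′ e″) e′) e) b

shift₂-lift : ∀ (f : ℕ → ℕ) → f 0 ≡ 0 → ∀ j i l F b e → f (shift₂ j i l F b e) ≡ shift₂ j i l (λ x z → f (F x z)) b e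
shift₂-lift f f0≡0 j i l F b e =
  trans (shift-lift f f0≡0 j _ b) (shift-cong j b (λ x →
    trans (shift-lift f f0≡0 i _ e) (shift-cong i e (λ y → shift-lift f f0≡0 l _ y))))

shift₂-cong-at : ∀ j i l b e {F G : ℕ → ℕ → ℕ} →
  (∀ x z → bool→ℕ j + x ≡ b → bool→ℕ i + (bool→ℕ l + z) ≡ e → F x z ≡ G x z) → shift₂ j i l F b e ≡ shift₂ j i l G b e
shift₂-cong-at j i l b e F≗G = shift-cong-at j b (λ x ex → shift-cong-at i e (λ y ey → shift-cong-at l y (λ z ez →
  F≗G x z ex (trans (cong (bool→ℕ i +_) ez) ey))))

shift₂-product : ∀ j i l (F G : ℕ → ℕ) b e → shift₂ j i l (λ x z → F x * G z) b e ≡ shift j F b * shift i (shift l G) e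
shift₂-product j i l F G b e = sym (begin
  shift j F b * sG                                          ≡⟨ shift-lift (_* sG) refl j F b ⟩
  shift j (λ x → F x * sG) b                                ≡⟨ shift-cong j b (λ x →
                                                                 shift-lift (F x *_) (*-zeroʳ (F x)) i _ e) ⟩
  shift j (λ x → shift i (λ y → F x * shift l G y) e) b     ≡⟨ shift-cong j b (λ x → shift-cong i e (λ y →
                                                                 shift-lift (F x *_) (*-zeroʳ (F x)) l G y)) ⟩
  shift₂ j i l (λ x z → F x * G z) b e                      ∎)
  where
  open ≡-Reasoning
  sG = shift i (shift l G) e

sum-shift₂ : ∀ {A : Set} j i l (G : A → ℕ → ℕ → ℕ) b e (xs : List A) →
  sum (map (λ x → shift₂ j i l (G x) b e) xs) ≡ shift₂ j i l (λ b′ e′ → sum (map (λ x → G x b′ e′) xs)) b e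
sum-shift₂ j i l G b e xs =
  trans (sum-shift j _ b xs) (shift-cong j b (λ x →
    trans (sum-shift i _ e xs) (shift-cong i e (λ y → sum-shift l _ y xs))))

forestIndicator₂ : ℕ → ℕ → ℕ → List Kind → ℕ
forestIndicator₂ r b e κs = ifEq (middles κs) b (ifEq (lefts κs + rights κs) e (bool→ℕ (isForest r κs)))

forestCount₂ : ℕ → ℕ → ℕ → ℕ → ℕ
forestCount₂ r n b e = sum (map (forestIndicator₂ r b e) (kindWords n))

forestIndicator₂-∷ : ∀ r b e i j l κs → forestIndicator₂ (suc r) b e (kind i j l ∷ κs) ≡
  shift₂ j i l (λ b′ e′ → forestIndicator₂ (r + degree (kind i j l)) b′ e′ κs) b e
forestIndicator₂-∷ r b e i j l κs = begin
  ifEq (bool→ℕ j + y) b (ifEq ((bool→ℕ i + x) + (bool→ℕ l + z)) e W)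
    ≡⟨ cong (λ u → ifEq (bool→ℕ j + y) b (ifEq u e W)) (regroup (bool→ℕ i) (bool→ℕ l) x z) ⟩
  ifEq (bool→ℕ j + y) b (ifEq (bool→ℕ i + (bool→ℕ l + (x + z))) e W)
    ≡⟨ cong (ifEq (bool→ℕ j + y) b) (trans (ifEq-+ i (bool→ℕ l + (x + z)) e W) (shift-cong i e (λ e′ → ifEq-+ l (x + z) e′ W))) ⟩
  ifEq (bool→ℕ j + y) b (shift i (λ e′ → shift l (λ e″ → ifEq (x + z) e″ W) e′) e)
    ≡⟨ ifEq-+ j y b _ ⟩
  shift j (λ b′ → ifEq y b′ (shift i (λ e′ → shift l (λ e″ → ifEq (x + z) e″ W) e′) e)) b
    ≡⟨ shift-cong j b (λ b′ → trans (ifEq-shift y b′ i e _) (shift-cong i e (λ e′ → ifEq-shift y b′ l e′ _))) ⟩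
  shift₂ j i l (λ b′ e′ → forestIndicator₂ (r + degree (kind i j l)) b′ e′ κs) b e ∎
  where
  open ≡-Reasoning
  x = lefts κs
  y = middles κs
  z = rights κs
  W = bool→ℕ (isForest (r + degree (kind i j l)) κs)
  regroup : ∀ i l x z → (i + x) + (l + z) ≡ i + (l + (x + z))
  regroup = solve-∀

forestCount₂-afterRoot : ℕ → ℕ → ℕ → ℕ → Kind → ℕ
forestCount₂-afterRoot r n b e (kind i j l) = shift₂ j i l (forestCount₂ (r + degree (kind i j l)) n) b e

forestCount₂-suc : ∀ r n b e → forestCount₂ (suc r) (suc n) b e ≡ sum (map (forestCount₂-afterRoot r n b e) allKinds)
forestCount₂-suc r n b e = trans (sum-tuples-suc allKinds (forestIndicator₂ (suc r) b e) n) (sum-map-cong allKinds (λ κ _ → root κ))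
  where
  root : ∀ κ → sum (map (λ κs → forestIndicator₂ (suc r) b e (κ ∷ κs)) (kindWords n)) ≡ forestCount₂-afterRoot r n b e κ
  root (kind i j l) =
    trans (sum-map-cong (kindWords n) (λ κs _ → forestIndicator₂-∷ r b e i j l κs)) (sum-shift₂ j i l _ b e (kindWords n))

forestCount₂-no-trees : ∀ n b e → forestCount₂ 0 (suc n) b e ≡ 0
forestCount₂-no-trees n b e = sum-kindWords-suc≡0 n (forestIndicator₂ 0 b e) (λ κ κs →
  trans (cong (ifEq (middles (κ ∷ κs)) b) (ifEq-0 (lefts (κ ∷ κs) + rights (κ ∷ κs)) e)) (ifEq-0 (middles (κ ∷ κs)) b))

ForestFormula₂ : ℕ → Set
ForestFormula₂ n = ∀ r b e → r + b + e ≡ n → n * forestCount₂ r n b e ≡ r * (binom n b * binom (double n) e)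

kindBinom₂ : ℕ → ℕ → ℕ → Kind → ℕ
kindBinom₂ N b e (kind i j l) = shift j (binom N) b * shift i (shift l (binom (double N))) e

forestCount₂-afterRoot-formula : ∀ {N} → ForestFormula₂ N → ∀ r b e → r + b + e ≡ N → ∀ κ →
  N * forestCount₂-afterRoot r N b e κ ≡ (r + degree κ) * kindBinom₂ N b e κ
forestCount₂-afterRoot-formula {N} IH r b e h (kind i j l) = begin
  N * shift₂ j i l (forestCount₂ (r + d) N) b e
    ≡⟨ shift₂-lift (N *_) (*-zeroʳ N) j i l _ b e ⟩
  shift₂ j i l (λ x z → N * forestCount₂ (r + d) N x z) b e
    ≡⟨ shift₂-cong-at j i l b e (λ x z ex ez → IH (r + d) x z (subtree-sizes x z ex ez)) ⟩
  shift₂ j i l (λ x z → (r + d) * (binom N x * binom (double N) z)) b e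
    ≡⟨ shift₂-lift ((r + d) *_) (*-zeroʳ (r + d)) j i l _ b e ⟨
  (r + d) * shift₂ j i l (λ x z → binom N x * binom (double N) z) b e
    ≡⟨ cong ((r + d) *_) (shift₂-product j i l (binom N) (binom (double N)) b e) ⟩
  (r + d) * kindBinom₂ N b e (kind i j l) ∎
  where
  open ≡-Reasoning
  d = degree (kind i j l)
  regroup : ∀ r i j l x z → r + (j + x) + (i + (l + z)) ≡ r + (i + j + l) + x + z
  regroup = solve-∀
  subtree-sizes : ∀ x z → bool→ℕ j + x ≡ b → bool→ℕ i + (bool→ℕ l + z) ≡ e → r + d + x + z ≡ N
  subtree-sizes x z refl refl = trans (sym (regroup r (bool→ℕ i) (bool→ℕ j) (bool→ℕ l) x z)) h

forestFormula₂-step-identity : ∀ N r b e → r + b + e ≡ N →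
  suc N * sum (map (λ κ → (r + degree κ) * kindBinom₂ N b e κ) allKinds) ≡
  N * (suc r * (binom (suc N) b * binom (double (suc N)) e))
forestFormula₂-step-identity N r b e h = begin
  suc N * ((r + 0) * (X₀ * E₀₀) + ((r + 1) * (X₀ * E₁₀) + ((r + 1) * (X₁ * E₀₀) +
    ((r + 2) * (X₁ * E₁₀) + ((r + 1) * (X₀ * E₁₀) + ((r + 2) * (X₀ * E₁₁) +
    ((r + 2) * (X₁ * E₁₀) + ((r + 3) * (X₁ * E₁₁) + 0))))))))
    ≡⟨ expand N r X₀ X₁ E₀₀ E₁₀ E₁₁ ⟩
  suc N * r * (X * E) + (suc N * X₁) * E + X * (suc (suc (N + N)) * (E₁₁ + E₁₀))
    ≡⟨ cong₂ (λ u v → suc N * r * (X * E) + u * E + X * v) absorb-middle absorb-outer ⟩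
  suc N * r * (X * E) + (b * X) * E + X * (e * E)
    ≡⟨ collect N r b e X E ⟩
  (N * r + (r + b + e)) * (X * E)
    ≡⟨ cong (λ u → (N * r + u) * (X * E)) h ⟩
  (N * r + N) * (X * E)
    ≡⟨ factor N r (X * E) ⟩
  N * (suc r * (X * E))
    ≡⟨ cong₂ (λ u v → N * (suc r * (u * v))) (binom-pascal N b) (binom-pascal₂ M e) ⟨
  N * (suc r * (binom (suc N) b * binom (double (suc N)) e)) ∎
  where
  open ≡-Reasoning
  M = double N
  X₀ = binom N b
  X₁ = shift true (binom N) b
  E₀₀ = binom M e
  E₁₀ = shift true (binom M) e
  E₁₁ = shift true (shift true (binom M)) e
  X = X₁ + X₀
  E = E₁₁ + E₁₀ + E₁₀ + E₀₀
  absorb-middle : suc N * X₁ ≡ b * X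
  absorb-middle = trans (suc-*-shift-binom N b) (cong (b *_) (binom-pascal N b))
  absorb-outer : suc (suc (N + N)) * (E₁₁ + E₁₀) ≡ e * E
  absorb-outer = begin
    suc (suc (N + N)) * (E₁₁ + E₁₀)   ≡⟨ cong (λ u → suc (suc u) * (E₁₁ + E₁₀)) (trans (double≡2* N) (cong (N +_) (+-identityʳ N))) ⟨
    suc (suc M) * (E₁₁ + E₁₀)         ≡⟨ cong (suc (suc M) *_) (shift-binom-pascal M e) ⟨
    suc (suc M) * shift true (binom (suc M)) e ≡⟨ suc-*-shift-binom (suc M) e ⟩
    e * binom (suc (suc M)) e         ≡⟨ cong (e *_) (binom-pascal₂ M e) ⟩
    e * E                             ∎
  expand : ∀ N r X₀ X₁ E₀₀ E₁₀ E₁₁ →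
    suc N * ((r + 0) * (X₀ * E₀₀) + ((r + 1) * (X₀ * E₁₀) + ((r + 1) * (X₁ * E₀₀) +
      ((r + 2) * (X₁ * E₁₀) + ((r + 1) * (X₀ * E₁₀) + ((r + 2) * (X₀ * E₁₁) +
      ((r + 2) * (X₁ * E₁₀) + ((r + 3) * (X₁ * E₁₁) + 0))))))))
    ≡ suc N * r * ((X₁ + X₀) * (E₁₁ + E₁₀ + E₁₀ + E₀₀)) + (suc N * X₁) * (E₁₁ + E₁₀ + E₁₀ + E₀₀)
      + (X₁ + X₀) * (suc (suc (N + N)) * (E₁₁ + E₁₀))
  expand = solve-∀
  collect : ∀ N r b e X E → suc N * r * (X * E) + (b * X) * E + X * (e * E) ≡ (N * r + (r + b + e)) * (X * E)
  collect = solve-∀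

forestFormula₂-step : ∀ {N} .{{_ : NonZero N}} → ForestFormula₂ N → ∀ r b e → suc r + b + e ≡ suc N →
  suc N * forestCount₂ (suc r) (suc N) b e ≡ suc r * (binom (suc N) b * binom (double (suc N)) e)
forestFormula₂-step {N} IH r b e h = *-cancelˡ-≡ _ _ N (begin
  N * (suc N * forestCount₂ (suc r) (suc N) b e)                    ≡⟨ *-comm-middle N (suc N) _ ⟩
  suc N * (N * forestCount₂ (suc r) (suc N) b e)                    ≡⟨ cong (λ u → suc N * (N * u)) (forestCount₂-suc r N b e) ⟩
  suc N * (N * sum (map (forestCount₂-afterRoot r N b e) allKinds)) ≡⟨ cong (suc N *_) (*-distribˡ-sum N (forestCount₂-afterRoot r N b e) allKinds) ⟩
  suc N * sum (map (λ κ → N * forestCount₂-afterRoot r N b e κ) allKinds)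
    ≡⟨ cong (suc N *_) (sum-map-cong allKinds (λ κ _ → forestCount₂-afterRoot-formula IH r b e h′ κ)) ⟩
  suc N * sum (map (λ κ → (r + degree κ) * kindBinom₂ N b e κ) allKinds)
    ≡⟨ forestFormula₂-step-identity N r b e h′ ⟩
  N * (suc r * (binom (suc N) b * binom (double (suc N)) e)) ∎)
  where
  open ≡-Reasoning
  h′ : r + b + e ≡ N
  h′ = suc-injective h

forestFormula₂ : ∀ n → ForestFormula₂ n
forestFormula₂ zero          r             b       e       h rewrite m+n≡0⇒m≡0 r (m+n≡0⇒m≡0 (r + b) h) = refl
forestFormula₂ (suc n)       zero          b       e       h = trans (cong (suc n *_) (forestCount₂-no-trees n b e)) (*-zeroʳ (suc n))
forestFormula₂ (suc zero)    (suc zero)    zero    zero    refl = refl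
forestFormula₂ (suc zero)    (suc (suc r)) b       e       ()
forestFormula₂ (suc zero)    (suc zero)    (suc b) e       ()
forestFormula₂ (suc zero)    (suc zero)    zero    (suc e) ()
forestFormula₂ (suc (suc n)) (suc r)       b       e       h = forestFormula₂-step (forestFormula₂ (suc n)) r b e h

-- Ternary trees and their preorder words

data Tree : Set where
  leaf : Tree
  node : (left middle right : Tree) → Tree

size : Tree → ℕ
size leaf         = 0
size (node L M R) = suc (size L + size M + size R)

height : Tree → ℕ
height leaf         = 0
height (node L M R) = suc (height L ⊔ height M ⊔ height R)

nonempty : Tree → Bool
nonempty leaf         = false
nonempty (node _ _ _) = true

preorder : Tree → List Kind
preorder leaf         = []
preorder (node L M R) = kind (nonempty L) (nonempty M) (nonempty R) ∷ (preorder L ++ (preorder M ++ preorder R))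

nodeOf : Tree → Tree × Tree → Tree
nodeOf L (M , R) = node L M R

treesOfHeight≤ : ℕ → List Tree
treesOfHeight≤ zero    = leaf ∷ []
treesOfHeight≤ (suc f) = leaf ∷ cartesianProductWith nodeOf (treesOfHeight≤ f) (cartesianProduct (treesOfHeight≤ f) (treesOfHeight≤ f))

trees : ℕ → List Tree
trees n = filter (λ t → size t ≟ n) (treesOfHeight≤ n)

nodeOf-injective : ∀ {L L′ MR MR′} → nodeOf L MR ≡ nodeOf L′ MR′ → L ≡ L′ × MR ≡ MR′
nodeOf-injective {MR = _ , _} {MR′ = _ , _} refl = refl , refl

treesOfHeight≤-unique : ∀ f → Unique (treesOfHeight≤ f)
treesOfHeight≤-unique zero    = [] ∷ []
treesOfHeight≤-unique (suc f) =
  All.tabulate leaf∉ ∷ Unique.cartesianProductWith⁺ nodeOf nodeOf-injective Ts! (Unique.cartesianProduct⁺ Ts! Ts!)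
  where
  Ts = treesOfHeight≤ f
  Ts! = treesOfHeight≤-unique f
  leaf∉ : ∀ {t} → t ∈ cartesianProductWith nodeOf Ts (cartesianProduct Ts Ts) → leaf ≢ t
  leaf∉ t∈ with ∈-cartesianProductWith⁻ nodeOf Ts (cartesianProduct Ts Ts) t∈
  ... | _ , (_ , _) , _ , _ , refl = λ ()

∈-treesOfHeight≤ : ∀ {f} t → height t ≤ f → t ∈ treesOfHeight≤ f
∈-treesOfHeight≤ {zero}  leaf         _ = here refl
∈-treesOfHeight≤ {suc f} leaf         _ = here refl
∈-treesOfHeight≤ {suc f} (node L M R) (s≤s h) = there (∈-cartesianProductWith⁺ nodeOf
  (∈-treesOfHeight≤ L (≤-trans (≤-trans (m≤m⊔n (height L) (height M)) (m≤m⊔n _ (height R))) h))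
  (∈-cartesianProduct⁺ (∈-treesOfHeight≤ M (≤-trans (≤-trans (m≤n⊔m (height L) (height M)) (m≤m⊔n _ (height R))) h))
                       (∈-treesOfHeight≤ R (≤-trans (m≤n⊔m (height L ⊔ height M) (height R)) h))))

height≤size : ∀ t → height t ≤ size t
height≤size leaf         = z≤n
height≤size (node L M R) = s≤s (⊔-lub (⊔-lub (≤-trans (height≤size L) (≤-trans (m≤m+n _ _) (m≤m+n _ _)))
  (≤-trans (height≤size M) (≤-trans (m≤n+m _ (size L)) (m≤m+n _ _)))) (≤-trans (height≤size R) (m≤n+m _ _)))

∈-trees⁺ : ∀ t → t ∈ trees (size t)
∈-trees⁺ t = ∈-filter⁺ (λ t → size t ≟ _) (∈-treesOfHeight≤ t (height≤size t)) refl

∈-trees⁻ : ∀ {n t} → t ∈ trees n → size t ≡ n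
∈-trees⁻ {n} t∈ = proj₂ (∈-filter⁻ (λ t → size t ≟ n) {xs = treesOfHeight≤ n} t∈)

trees-unique : ∀ n → Unique (trees n)
trees-unique n = Unique.filter⁺ (λ t → size t ≟ n) (treesOfHeight≤-unique n)

length-preorder : ∀ t → length (preorder t) ≡ size t
length-preorder leaf         = refl
length-preorder (node L M R) = cong suc (begin
  length (preorder L ++ (preorder M ++ preorder R))             ≡⟨ length-++ (preorder L) ⟩
  length (preorder L) + length (preorder M ++ preorder R)      ≡⟨ cong (length (preorder L) +_) (length-++ (preorder M)) ⟩
  length (preorder L) + (length (preorder M) + length (preorder R))
    ≡⟨ cong₃ (λ a b c → a + (b + c)) (length-preorder L) (length-preorder M) (length-preorder R) ⟩
  size L + (size M + size R)                                   ≡⟨ +-assoc (size L) _ _ ⟨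
  size L + size M + size R                                     ∎)
  where open ≡-Reasoning

preorder-++ : ∀ L M R u → (preorder L ++ (preorder M ++ preorder R)) ++ u ≡ preorder L ++ (preorder M ++ (preorder R ++ u))
preorder-++ L M R u = trans (++-assoc (preorder L) _ u) (cong (preorder L ++_) (++-assoc (preorder M) _ u))

isForest-preorder : ∀ t r u → isForest (bool→ℕ (nonempty t) + r) (preorder t ++ u) ≡ isForest r u
isForest-preorder leaf         r u = refl
isForest-preorder (node L M R) r u = begin
  isForest (r + (a + b + c)) ((preorder L ++ (preorder M ++ preorder R)) ++ u)
    ≡⟨ cong₂ isForest (regroup r a b c) (preorder-++ L M R u) ⟩
  isForest (a + (b + (c + r))) (preorder L ++ (preorder M ++ (preorder R ++ u)))
    ≡⟨ isForest-preorder L _ _ ⟩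
  isForest (b + (c + r)) (preorder M ++ (preorder R ++ u))
    ≡⟨ isForest-preorder M _ _ ⟩
  isForest (c + r) (preorder R ++ u)
    ≡⟨ isForest-preorder R _ _ ⟩
  isForest r u ∎
  where
  open ≡-Reasoning
  a = bool→ℕ (nonempty L)
  b = bool→ℕ (nonempty M)
  c = bool→ℕ (nonempty R)
  regroup : ∀ r a b c → r + (a + b + c) ≡ a + (b + (c + r))
  regroup = solve-∀

isForest-1-preorder : ∀ t → nonempty t ≡ true → isForest 1 (preorder t) ≡ true
isForest-1-preorder t t≢leaf = begin
  isForest 1 (preorder t)                                  ≡⟨ cong (λ b → isForest (bool→ℕ b + 0) (preorder t)) t≢leaf ⟨
  isForest (bool→ℕ (nonempty t) + 0) (preorder t)          ≡⟨ cong (isForest (bool→ℕ (nonempty t) + 0)) (++-identityʳ (preorder t)) ⟨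
  isForest (bool→ℕ (nonempty t) + 0) (preorder t ++ [])    ≡⟨ isForest-preorder t 0 [] ⟩
  true                                                      ∎
  where open ≡-Reasoning

preorder-++-injective : ∀ t t′ u u′ → nonempty t ≡ nonempty t′ → preorder t ++ u ≡ preorder t′ ++ u′ → t ≡ t′ × u ≡ u′
preorder-++-injective leaf         leaf            u u′ _ eq = refl , eq
preorder-++-injective (node L M R) (node L′ M′ R′) u u′ _ eq with ∷-injective eq
... | heads , tails with kind-injective heads
... | eL , eM , eR with preorder-++-injective L L′ _ _ eL (trans (sym (preorder-++ L M R u)) (trans tails (preorder-++ L′ M′ R′ u′)))
... | refl , restL with preorder-++-injective M M′ _ _ eM restL
... | refl , restM with preorder-++-injective R R′ _ _ eR restM
... | refl , refl = refl , refl

preorder-injective : ∀ {t t′} → preorder t ≡ preorder t′ → t ≡ t′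
preorder-injective {leaf}       {leaf}       _  = refl
preorder-injective {node _ _ _} {node _ _ _} eq =
  proj₁ (preorder-++-injective _ _ [] [] refl (trans (++-identityʳ _) (trans eq (sym (++-identityʳ _)))))

length-≤-++ : ∀ {A : Set} (p u : List A) → length u ≤ length (p ++ u)
length-≤-++ p u = subst (length u ≤_) (sym (length-++ p)) (m≤n+m _ _)

private
  degree-assoc : ∀ r i j l → i + (j + (l + r)) ≡ r + (i + j + l)
  degree-assoc = solve-∀

parseTree : ∀ f β r κs → length κs ≤ f → isForest (bool→ℕ β + r) κs ≡ true →
  Σ Tree λ t → nonempty t ≡ β × Σ (List Kind) λ u → κs ≡ preorder t ++ u × isForest r u ≡ true
parseTree f       false r κs                _          valid = leaf , refl , κs , refl , valid
parseTree f       true  r []                _          ()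
parseTree zero    true  r (κ ∷ κs)          ()         valid
parseTree (suc f) true  r (kind i j l ∷ κs) (s≤s len≤) valid
  with parseTree f i (bool→ℕ j + (bool→ℕ l + r)) κs len≤ (trans (cong (λ k → isForest k κs) (degree-assoc r (bool→ℕ i) (bool→ℕ j) (bool→ℕ l))) valid)
... | L , refl , u₁ , refl , valid₁
  with parseTree f j (bool→ℕ l + r) u₁ (≤-trans (length-≤-++ (preorder L) u₁) len≤) valid₁
... | M , refl , u₂ , refl , valid₂
  with parseTree f l r u₂ (≤-trans (length-≤-++ (preorder M) u₂) (≤-trans (length-≤-++ (preorder L) u₁) len≤)) valid₂
... | R , refl , u₃ , refl , valid₃ = node L M R , refl , u₃ , cong (kind i j l ∷_) (sym (preorder-++ L M R u₃)) , valid₃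

∈-allKinds : ∀ κ → κ ∈ allKinds
∈-allKinds (kind i j l) = ∈-cartesianProductWith⁺ (λ i jl → kind i (proj₁ jl) (proj₂ jl)) (∈-bools i) (∈-cartesianProduct⁺ (∈-bools j) (∈-bools l))
  where
  ∈-bools : ∀ b → b ∈ bools
  ∈-bools false = here refl
  ∈-bools true  = there (here refl)

allKinds-unique : Unique allKinds
allKinds-unique = Unique.cartesianProductWith⁺ _ kind-split-injective bools! (Unique.cartesianProduct⁺ bools! bools!)
  where
  bools! : Unique bools
  bools! = ((λ ()) ∷ []) ∷ [] ∷ []
  kind-split-injective : ∀ {i i′ jl jl′} → kind i (proj₁ jl) (proj₂ jl) ≡ kind i′ (proj₁ jl′) (proj₂ jl′) → i ≡ i′ × jl ≡ jl′
  kind-split-injective {jl = _ , _} {jl′ = _ , _} refl = refl , refl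

isForest-length : ∀ r κs → isForest r κs ≡ true → r + lefts κs + middles κs + rights κs ≡ length κs
isForest-length zero    []                _     = refl
isForest-length (suc r) (kind i j l ∷ κs) valid =
  trans (regroup r (bool→ℕ i) (bool→ℕ j) (bool→ℕ l) (lefts κs) (middles κs) (rights κs))
        (cong suc (isForest-length (r + degree (kind i j l)) κs valid))
  where
  regroup : ∀ r i j l a b c → suc r + (i + a) + (j + b) + (l + c) ≡ suc (r + (i + j + l) + a + b + c)
  regroup = solve-∀

forestWord-size : ∀ {n κs} → κs ∈ kindWords n → isForest 1 κs ≡ true → 1 + lefts κs + middles κs + rights κs ≡ n
forestWord-size {n} {κs} κs∈ valid = trans (isForest-length 1 κs valid) (proj₁ (∈-tuples⁻ allKinds n κs∈))

forestWords : ℕ → List (List Kind)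
forestWords n = filter (λ κs → isForest 1 κs Bool.≟ true) (kindWords n)

nonempty-size : ∀ t → 1 ≤ size t → nonempty t ≡ true
nonempty-size (node _ _ _) _ = refl

preorder-trees↭forestWords : ∀ n → 1 ≤ n → map preorder (trees n) ↭ forestWords n
preorder-trees↭forestWords n 1≤n =
  unique-⇔⇒↭ (Unique.map⁺ preorder-injective (trees-unique n)) (Unique.filter⁺ _ (tuples-unique allKinds allKinds-unique n)) to from
  where
  to : ∀ {κs} → κs ∈ map preorder (trees n) → κs ∈ forestWords n
  to κs∈ with ∈-map⁻ preorder κs∈
  ... | t , t∈ , refl with ∈-trees⁻ {n} t∈
  ... | refl = ∈-filter⁺ _ (subst (λ k → preorder t ∈ kindWords k) (length-preorder t) (∈-tuples⁺ allKinds (All.tabulate (λ {κ} _ → ∈-allKinds κ))))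
                           (isForest-1-preorder t (nonempty-size t 1≤n))
  from : ∀ {κs} → κs ∈ forestWords n → κs ∈ map preorder (trees n)
  from {κs} κs∈ with ∈-filter⁻ _ κs∈
  ... | κs∈words , valid with parseTree (length κs) true 0 κs ≤-refl valid
  ... | t , _ , _ ∷ _ , _ , ()
  ... | t , _ , [] , refl , _ = subst (_∈ map preorder (trees n)) (sym (++-identityʳ (preorder t)))
    (∈-map⁺ preorder (subst (λ k → t ∈ trees k) size≡n (∈-trees⁺ t)))
    where
    size≡n : size t ≡ n
    size≡n = trans (sym (length-preorder t)) (trans (cong length (sym (++-identityʳ (preorder t)))) (proj₁ (∈-tuples⁻ allKinds n κs∈words)))

sum-trees : ∀ n → 1 ≤ n → (h : List Kind → ℕ) →
  sum (map (λ t → h (preorder t)) (trees n)) ≡ sum (map (λ κs → if isForest 1 κs then h κs else 0) (kindWords n))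
sum-trees n 1≤n h = begin
  sum (map (λ t → h (preorder t)) (trees n))      ≡⟨ sum-map-map h preorder (trees n) ⟨
  sum (map h (map preorder (trees n)))            ≡⟨ sum-map-↭ h (preorder-trees↭forestWords n 1≤n) ⟩
  sum (map h (forestWords n))                     ≡⟨ sum-filter (λ κs → isForest 1 κs Bool.≟ true) h (kindWords n) ⟩
  sum (map (λ κs → if does (isForest 1 κs Bool.≟ true) then h κs else 0) (kindWords n))
    ≡⟨ sum-map-cong (kindWords n) (λ κs _ → if-≟-true (isForest 1 κs) (h κs)) ⟩
  sum (map (λ κs → if isForest 1 κs then h κs else 0) (kindWords n)) ∎
  where
  open ≡-Reasoning
  if-≟-true : ∀ b x → (if does (b Bool.≟ true) then x else 0) ≡ (if b then x else 0)
  if-≟-true true  x = refl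
  if-≟-true false x = refl

-- Flattening a tree into a 213-avoiding Stirling permutation

StirlingTriple : ℕ → ℕ → ℕ → Set
StirlingTriple x y z = x ≡ z → x < y

No213 : ℕ → ℕ → ℕ → Set
No213 x y z = ¬ (y < x × x < z)

AllTriples : (ℕ → ℕ → ℕ → Set) → List ℕ → Set
AllTriples R []      = ⊤
AllTriples R (x ∷ σ) = AllPairs (R x) σ × AllTriples R σ

Exceeds : List ℕ → List ℕ → Set
Exceeds u v = All (λ p → All (_< p) v) u

InRange : ℕ → ℕ → ℕ → Set
InRange lo hi y = lo < y × y ≤ hi

InRange-weaken : ∀ {lo hi lo′ hi′} → lo′ ≤ lo → hi ≤ hi′ → ∀ {y} → InRange lo hi y → InRange lo′ hi′ y
InRange-weaken lo′≤lo hi≤hi′ (lo<y , y≤hi) = ≤-<-trans lo′≤lo lo<y , ≤-trans y≤hi hi≤hi′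

module _ {P : ℕ → Set} where

  lookup⇒All : ∀ σ → (∀ c → P (lookup σ c)) → All P σ
  lookup⇒All []      _ = []
  lookup⇒All (x ∷ σ) f = f Fin.zero ∷ lookup⇒All σ (λ c → f (Fin.suc c))

  All⇒lookup : ∀ {σ} → All P σ → ∀ c → P (lookup σ c)
  All⇒lookup (p ∷ _)  Fin.zero    = p
  All⇒lookup (_ ∷ ps) (Fin.suc c) = All⇒lookup ps c

module _ {S : ℕ → ℕ → Set} where

  lookup⇒AllPairs : ∀ σ → (∀ b c → b Fin.< c → S (lookup σ b) (lookup σ c)) → AllPairs S σ
  lookup⇒AllPairs []      _ = []
  lookup⇒AllPairs (y ∷ σ) f =
    lookup⇒All σ (λ c → f Fin.zero (Fin.suc c) (s≤s z≤n)) ∷ lookup⇒AllPairs σ (λ b c b<c → f (Fin.suc b) (Fin.suc c) (s≤s b<c))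

  AllPairs⇒lookup : ∀ {σ} → AllPairs S σ → ∀ b c → b Fin.< c → S (lookup σ b) (lookup σ c)
  AllPairs⇒lookup (p ∷ _)  Fin.zero    (Fin.suc c) _         = All⇒lookup p c
  AllPairs⇒lookup (_ ∷ ps) (Fin.suc b) (Fin.suc c) (s≤s b<c) = AllPairs⇒lookup ps b c b<c

  AllPairs-++⁻ : ∀ u {v} → AllPairs S (u ++ v) → AllPairs S u × All (λ x → All (S x) v) u × AllPairs S v
  AllPairs-++⁻ []      Sv          = [] , [] , Sv
  AllPairs-++⁻ (x ∷ u) (Sx ∷ Suv) with AllPairs-++⁻ u Suv
  ... | Su , Suv′ , Sv = (All.++⁻ˡ u Sx ∷ Su) , (All.++⁻ʳ u Sx ∷ Suv′) , Sv

  allPairs : ∀ {P : ℕ → Set} {u} → All P u → (∀ {y z} → P y → P z → S y z) → AllPairs S u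
  allPairs []       _ = []
  allPairs (p ∷ ps) f = All.map (f p) ps ∷ allPairs ps f

module _ {R : ℕ → ℕ → ℕ → Set} where

  lookup⇒AllTriples : ∀ σ → (∀ a b c → a Fin.< b → b Fin.< c → R (lookup σ a) (lookup σ b) (lookup σ c)) → AllTriples R σ
  lookup⇒AllTriples []      _ = tt
  lookup⇒AllTriples (x ∷ σ) f =
    lookup⇒AllPairs σ (λ b c b<c → f Fin.zero (Fin.suc b) (Fin.suc c) (s≤s z≤n) (s≤s b<c)) ,
    lookup⇒AllTriples σ (λ a b c a<b b<c → f (Fin.suc a) (Fin.suc b) (Fin.suc c) (s≤s a<b) (s≤s b<c))

  AllTriples⇒lookup : ∀ {σ} → AllTriples R σ → ∀ a b c → a Fin.< b → b Fin.< c → R (lookup σ a) (lookup σ b) (lookup σ c)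
  AllTriples⇒lookup {_ ∷ _} (p , _) Fin.zero    (Fin.suc b) (Fin.suc c) _         (s≤s b<c) = AllPairs⇒lookup p b c b<c
  AllTriples⇒lookup {_ ∷ _} (_ , q) (Fin.suc a) (Fin.suc b) (Fin.suc c) (s≤s a<b) (s≤s b<c) = AllTriples⇒lookup q a b c a<b b<c

  AllTriples-++⁺ : ∀ u {v} → AllTriples R u → AllPairs (λ x y → All (R x y) v) u → All (λ x → AllPairs (R x) v) u →
    AllTriples R v → AllTriples R (u ++ v)
  AllTriples-++⁺ []      _          _          _          Rv = Rv
  AllTriples-++⁺ (x ∷ u) (Rx , Ru) (Rxy ∷ Ruv) (Rx′ ∷ Rv′) Rv = AllPairs.++⁺ Rx Rx′ Rxy , AllTriples-++⁺ u Ru Ruv Rv′ Rv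

  AllTriples-++⁻ : ∀ u {v} → AllTriples R (u ++ v) → AllTriples R u × All (λ x → AllPairs (R x) v) u × AllTriples R v
  AllTriples-++⁻ []      Rv         = tt , [] , Rv
  AllTriples-++⁻ (x ∷ u) (Rx , Ruv) with AllTriples-++⁻ u Ruv | AllPairs-++⁻ u Rx
  ... | Ru , Ru′ , Rv | Rxu , _ , Rxv = (Rxu , Ru) , Rxv ∷ Ru′ , Rv

  -- A triple with its last entry below its first one never matters for StirlingTriple or No213.
  AllTriples-++-Exceeds : (∀ {x y z} → z < x → R x y z) → ∀ {u v} → AllTriples R u → AllTriples R v → Exceeds u v → AllTriples R (u ++ v)
  AllTriples-++-Exceeds below {u} {v} Ru Rv u≻v = AllTriples-++⁺ u Ru
    (allPairs u≻v (λ v<x _ → All.map below v<x))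
    (All.map (λ v<x → allPairs v<x (λ _ z<x → below z<x)) u≻v) Rv

stirling-below : ∀ {x y z} → z < x → StirlingTriple x y z
stirling-below z<x x≡z = ⊥-elim (<-irrefl (sym x≡z) z<x)

no213-below : ∀ {x y z} → z < x → No213 x y z
no213-below z<x (_ , x<z) = <-asym z<x x<z

stirling-∷ : ∀ {x w} → All (x <_) w → AllPairs (StirlingTriple x) w
stirling-∷ x<w = allPairs x<w (λ _ x<z x≡z → ⊥-elim (<-irrefl x≡z x<z))

no213-∷ : ∀ {x w} → All (x ≤_) w → AllPairs (No213 x) w
no213-∷ x≤w = allPairs x≤w (λ x≤y _ (y<x , _) → <⇒≱ y<x x≤y)

-- flatten o t labels the nodes of t by o + 1, …, o + size t, each label written twice: a node labelled x
-- with subtrees L, M, R contributes  flatten L · x · flatten M · x · flatten R,  where x is the least label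
-- and the labels of L exceed those of M, which exceed those of R.
flatten : ℕ → Tree → List ℕ
flatten o leaf         = []
flatten o (node L M R) = flatten (suc o + size R + size M) L ++ (suc o ∷ (flatten (suc o + size R) M ++ (suc o ∷ flatten (suc o) R)))

private
  offset-total : ∀ o l m r → suc o + r + m + l ≡ o + suc (l + m + r)
  offset-total = solve-∀

  offset-middle≤ : ∀ o l m r → suc o + r + m ≤ o + suc (l + m + r)
  offset-middle≤ o l m r = subst (suc o + r + m ≤_) (offset-total o l m r) (m≤m+n (suc o + r + m) l)

flatten-range : ∀ o t → All (InRange o (o + size t)) (flatten o t)
flatten-range o leaf         = []
flatten-range o (node L M R) =
  All.++⁺ (All.map (InRange-weaken (≤-trans (n≤1+n o) (≤-trans (m≤m+n _ r) (m≤m+n _ m))) (≤-reflexive (offset-total o l m r)))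
                   (flatten-range _ L))
    (root ∷ All.++⁺ (All.map (InRange-weaken (≤-trans (n≤1+n o) (m≤m+n _ r)) (offset-middle≤ o l m r)) (flatten-range _ M))
      (root ∷ All.map (InRange-weaken (n≤1+n o) (≤-trans (m≤m+n (suc o + r) m) (offset-middle≤ o l m r))) (flatten-range _ R)))
  where
  l = size L
  m = size M
  r = size R
  root : InRange o (o + size (node L M R)) (suc o)
  root = n<1+n o , ≤-trans (m≤m+n (suc o) r) (≤-trans (m≤m+n _ m) (offset-middle≤ o l m r))

Exceeds-range : ∀ {lo hi lo′ hi′ u v} → All (InRange lo hi) u → All (InRange lo′ hi′) v → hi′ ≤ lo → Exceeds u v
Exceeds-range u∈ v∈ hi′≤lo = All.map (λ (lo<p , _) → All.map (λ (_ , q≤hi′) → ≤-<-trans (≤-trans q≤hi′ hi′≤lo) lo<p) v∈) u∈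

Exceeds-∷ : ∀ {x u v} → All (x <_) u → Exceeds u v → Exceeds u (x ∷ v)
Exceeds-∷ x<u u≻v = All.zipWith (λ (x<p , v<p) → x<p ∷ v<p) (x<u , u≻v)

Exceeds-++ : ∀ {u v w} → Exceeds u v → Exceeds u w → Exceeds u (v ++ w)
Exceeds-++ u≻v u≻w = All.zipWith (λ (v<p , w<p) → All.++⁺ v<p w<p) (u≻v , u≻w)

record NodeBlocks (x : ℕ) (a b c : List ℕ) : Set where
  field
    root<a : All (x <_) a
    root<b : All (x <_) b
    root<c : All (x <_) c
    b≻c    : Exceeds b (x ∷ c)
    a≻bc   : Exceeds a (x ∷ (b ++ (x ∷ c)))

flatten-blocks : ∀ o L M R → NodeBlocks (suc o) (flatten (suc o + size R + size M) L) (flatten (suc o + size R) M) (flatten (suc o) R)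
flatten-blocks o L M R = record
  { root<a = root<a
  ; root<b = root<b
  ; root<c = All.map proj₁ rR
  ; b≻c    = Exceeds-∷ root<b (Exceeds-range rM rR ≤-refl)
  ; a≻bc   = Exceeds-∷ root<a (Exceeds-++ (Exceeds-range rL rM ≤-refl) (Exceeds-∷ root<a (Exceeds-range rL rR (m≤m+n _ (size M)))))
  }
  where
  rL = flatten-range (suc o + size R + size M) L
  rM = flatten-range (suc o + size R) M
  rR = flatten-range (suc o) R
  root<a : All (suc o <_) (flatten (suc o + size R + size M) L)
  root<a = All.map (λ r → ≤-<-trans (≤-trans (m≤m+n (suc o) (size R)) (m≤m+n _ (size M))) (proj₁ r)) rL
  root<b : All (suc o <_) (flatten (suc o + size R) M)
  root<b = All.map (λ r → ≤-<-trans (m≤m+n (suc o) (size R)) (proj₁ r)) rM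

flatten-stirling : ∀ o t → AllTriples StirlingTriple (flatten o t)
flatten-stirling o leaf         = tt
flatten-stirling o (node L M R) =
  AllTriples-++-Exceeds stirling-below (flatten-stirling _ L) (from-root , inner) a≻bc
  where
  open NodeBlocks (flatten-blocks o L M R)
  fb = flatten (suc o + size R) M
  fc = flatten (suc o) R
  inner : AllTriples StirlingTriple (fb ++ (suc o ∷ fc))
  inner = AllTriples-++-Exceeds stirling-below (flatten-stirling _ M) (stirling-∷ root<c , flatten-stirling _ R) b≻c
  from-root : AllPairs (StirlingTriple (suc o)) (fb ++ (suc o ∷ fc))
  from-root = AllPairs.++⁺ (allPairs root<b (λ x<y _ _ → x<y))
                           (All.map (λ x<z x≡z → ⊥-elim (<-irrefl x≡z x<z)) root<c ∷ stirling-∷ root<c)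
                           (All.map (λ x<y → All.tabulate (λ _ _ → x<y)) root<b)

flatten-avoids213 : ∀ o t → AllTriples No213 (flatten o t)
flatten-avoids213 o leaf         = tt
flatten-avoids213 o (node L M R) =
  AllTriples-++-Exceeds no213-below (flatten-avoids213 _ L) (no213-∷ x≤rest , inner) a≻bc
  where
  open NodeBlocks (flatten-blocks o L M R)
  fb = flatten (suc o + size R) M
  fc = flatten (suc o) R
  x≤rest : All (suc o ≤_) (fb ++ (suc o ∷ fc))
  x≤rest = All.++⁺ (All.map <⇒≤ root<b) (≤-refl ∷ All.map <⇒≤ root<c)
  inner : AllTriples No213 (fb ++ (suc o ∷ fc))
  inner = AllTriples-++-Exceeds no213-below (flatten-avoids213 _ M) (no213-∷ (All.map <⇒≤ root<c) , flatten-avoids213 _ R) b≻c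

count-++ : ∀ v u w → count v (u ++ w) ≡ count v u + count v w
count-++ v u w = trans (cong length (filter-++ (v ≟_) u w)) (length-++ (filter (v ≟_) u))

count-∷-≢ : ∀ {v y} w → v ≢ y → count v (y ∷ w) ≡ count v w
count-∷-≢ w v≢y = cong length (filter-reject (_ ≟_) v≢y)

count-∷-≡ : ∀ v w → count v (v ∷ w) ≡ suc (count v w)
count-∷-≡ v w = cong length (filter-accept (v ≟_) refl)

count-0 : ∀ {v u} → All (v ≢_) u → count v u ≡ 0
count-0 {u = []}    []           = refl
count-0 {u = y ∷ u} (v≢y ∷ v∉u) = trans (count-∷-≢ u v≢y) (count-0 v∉u)

count≡0⇒ : ∀ v u → count v u ≡ 0 → All (v ≢_) u
count≡0⇒ v []      _  = []
count≡0⇒ v (y ∷ u) c≡0 with v ≟ y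
... | yes refl = ⊥-elim (1+n≢0 (trans (sym (count-∷-≡ v u)) c≡0))
... | no  v≢y  = v≢y ∷ count≡0⇒ v u (trans (sym (count-∷-≢ u v≢y)) c≡0)

split-at-first : ∀ v σ k → count v σ ≡ suc k →
  Σ (List ℕ) λ a → Σ (List ℕ) λ w → σ ≡ a ++ (v ∷ w) × All (v ≢_) a × count v w ≡ k
split-at-first v []      k ()
split-at-first v (y ∷ σ) k c≡ with v ≟ y
... | yes refl = [] , σ , refl , [] , suc-injective (trans (sym (count-∷-≡ v σ)) c≡)
... | no  v≢y with split-at-first v σ k (trans (sym (count-∷-≢ σ v≢y)) c≡)
...   | a , w , refl , v∉a , c≡k = y ∷ a , w , refl , v≢y ∷ v∉a , c≡k

count-outside : ∀ {lo hi v u} → All (InRange lo hi) u → v ≤ lo ⊎ hi < v → count v u ≡ 0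
count-outside {v = v} u∈ outside = count-0 (All.map (λ y∈ → apart y∈ outside) u∈)
  where
  apart : ∀ {lo hi y} → InRange lo hi y → v ≤ lo ⊎ hi < v → v ≢ y
  apart (lo<y , _)   (inj₁ v≤lo) refl = <-irrefl refl (≤-<-trans v≤lo lo<y)
  apart (_   , y≤hi) (inj₂ hi<v) refl = <-irrefl refl (≤-<-trans y≤hi hi<v)

count-blocks : ∀ {v x} a b c → v ≢ x → count v (a ++ (x ∷ (b ++ (x ∷ c)))) ≡ count v a + (count v b + count v c)
count-blocks {v} {x} a b c v≢x =
  trans (count-++ v a _) (cong (count v a +_) (trans (count-∷-≢ (b ++ (x ∷ c)) v≢x)
    (trans (count-++ v b _) (cong (count v b +_) (count-∷-≢ c v≢x)))))

flatten-count : ∀ o t v → InRange o (o + size t) v → count v (flatten o t) ≡ 2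
flatten-count o leaf         v (o<v , v≤o+0) = ⊥-elim (<-irrefl refl (<-≤-trans o<v (subst (v ≤_) (+-identityʳ o) v≤o+0)))
flatten-count o (node L M R) v (o<v , v≤hi) with <-cmp v (suc o)
... | tri< v<x _ _ = ⊥-elim (<-irrefl refl (<-≤-trans v<x o<v))
... | tri≈ _ refl _ =
  trans (count-++ v fa _) (cong₂ _+_ (count-outside rL (inj₁ (≤-trans (m≤m+n v r) (m≤m+n _ m))))
    (trans (count-∷-≡ v _) (cong suc (trans (count-++ v fb _)
      (cong₂ _+_ (count-outside rM (inj₁ (m≤m+n v r))) (trans (count-∷-≡ v fc) (cong suc (count-outside rR (inj₁ ≤-refl)))))))))
  where
  m = size M ; r = size R
  fa = flatten (v + r + m) L ; fb = flatten (v + r) M ; fc = flatten v R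
  rL = flatten-range (v + r + m) L ; rM = flatten-range (v + r) M ; rR = flatten-range v R
... | tri> _ v≢x x<v = trans (count-blocks fa fb fc v≢x) (by-block (v ≤? suc o + r) (v ≤? suc o + r + m))
  where
  l = size L ; m = size M ; r = size R
  fa = flatten (suc o + r + m) L ; fb = flatten (suc o + r) M ; fc = flatten (suc o) R
  rL = flatten-range (suc o + r + m) L ; rM = flatten-range (suc o + r) M ; rR = flatten-range (suc o) R
  by-block : Dec (v ≤ suc o + r) → Dec (v ≤ suc o + r + m) → count v fa + (count v fb + count v fc) ≡ 2
  by-block (yes v≤r) _ =
    cong₃ (λ p q s → p + (q + s)) (count-outside rL (inj₁ (≤-trans v≤r (m≤m+n _ m)))) (count-outside rM (inj₁ v≤r))
          (flatten-count (suc o) R v (x<v , v≤r))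
  by-block (no v≰r) (yes v≤m) =
    cong₃ (λ p q s → p + (q + s)) (count-outside rL (inj₁ v≤m)) (flatten-count (suc o + r) M v (≰⇒> v≰r , v≤m))
          (count-outside rR (inj₂ (≰⇒> v≰r)))
  by-block (no v≰r) (no v≰m) =
    cong₃ (λ p q s → p + (q + s)) (flatten-count (suc o + r + m) L v (≰⇒> v≰m , subst (v ≤_) (sym (offset-total o l m r)) v≤hi))
          (count-outside rM (inj₂ (≰⇒> v≰m))) (count-outside rR (inj₂ (≤-trans (m≤m+n _ m) (≰⇒> v≰m))))

-- Recovering the tree from a 213-avoiding Stirling permutation

record Flattenable (lo hi : ℕ) (σ : List ℕ) : Set where
  field
    twice    : ∀ v → InRange lo hi v → count v σ ≡ 2
    inRange  : All (InRange lo hi) σ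
    stirling : AllTriples StirlingTriple σ
    avoids   : AllTriples No213 σ

Unflattening : ℕ → ℕ → List ℕ → Set
Unflattening lo hi σ = Σ Tree λ t → lo + size t ≡ hi × σ ≡ flatten lo t

-- For p in a and z after x: z = p would put x < p between two copies of p, and p < z would make p x z a 213.
Exceeds-before-min : ∀ {x} a w → AllTriples StirlingTriple (a ++ (x ∷ w)) → AllTriples No213 (a ++ (x ∷ w)) →
  All (x <_) a → Exceeds a w
Exceeds-before-min {x} a w stirling avoids =
  go (proj₁ (proj₂ (AllTriples-++⁻ a stirling))) (proj₁ (proj₂ (AllTriples-++⁻ a avoids)))
  where
  below : ∀ {p z} → x < p → StirlingTriple p x z → No213 p x z → z < p
  below x<p s n = ≤∧≢⇒< (≮⇒≥ (λ p<z → n (x<p , p<z))) (λ z≡p → <-asym x<p (s (sym z≡p)))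
  go : ∀ {u} → All (λ p → AllPairs (StirlingTriple p) (x ∷ w)) u → All (λ p → AllPairs (No213 p) (x ∷ w)) u →
    All (x <_) u → Exceeds u w
  go []                 []                 []            = []
  go ((s ∷ _) ∷ stir)   ((n ∷ _) ∷ avoid)  (x<p ∷ x<u)   = All.zipWith (λ (s , n) → below x<p s n) (s , n) ∷ go stir avoid x<u

Flattenable-block : ∀ {lo hi σ p q} u → Flattenable lo hi σ → lo ≤ p → q ≤ hi →
  All (InRange p q) u → (∀ v → InRange p q v → count v σ ≡ count v u) →
  AllTriples StirlingTriple u → AllTriples No213 u → Flattenable p q u
Flattenable-block u F lo≤p q≤hi u∈ counts stirling avoids = record
  { twice    = λ v v∈ → trans (sym (counts v v∈)) (Flattenable.twice F v (InRange-weaken lo≤p q≤hi v∈))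
  ; inRange  = u∈
  ; stirling = stirling
  ; avoids   = avoids
  }

module UnflattenNode {lo hi} a b c (lo<hi : lo < hi)
  (x∉a : All (suc lo ≢_) a) (x∉b : All (suc lo ≢_) b) (x∉c : All (suc lo ≢_) c)
  (F : Flattenable lo hi (a ++ (suc lo ∷ (b ++ (suc lo ∷ c))))) where

  open Flattenable F
  x : ℕ
  x = suc lo
  σ : List ℕ
  σ = a ++ (x ∷ (b ++ (x ∷ c)))

  range-a : All (InRange lo hi) a
  range-a = All.++⁻ˡ a inRange
  range-bc : All (InRange lo hi) (b ++ (x ∷ c))
  range-bc = All.tail (All.++⁻ʳ a inRange)
  range-b : All (InRange lo hi) b
  range-b = All.++⁻ˡ b range-bc
  range-c : All (InRange lo hi) c
  range-c = All.tail (All.++⁻ʳ b range-bc)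

  above-x : ∀ {u} → All (InRange lo hi) u → All (x ≢_) u → All (x <_) u
  above-x u∈ x∉u = All.zipWith (λ ((lo<y , _) , x≢y) → ≤∧≢⇒< lo<y x≢y) (u∈ , x∉u)

  stirling-a : AllTriples StirlingTriple a
  stirling-a = proj₁ (AllTriples-++⁻ a stirling)
  stirling-bc : AllTriples StirlingTriple (b ++ (x ∷ c))
  stirling-bc = proj₂ (proj₂ (proj₂ (AllTriples-++⁻ a stirling)))
  stirling-b : AllTriples StirlingTriple b
  stirling-b = proj₁ (AllTriples-++⁻ b stirling-bc)
  stirling-c : AllTriples StirlingTriple c
  stirling-c = proj₂ (proj₂ (proj₂ (AllTriples-++⁻ b stirling-bc)))

  avoids-a : AllTriples No213 a
  avoids-a = proj₁ (AllTriples-++⁻ a avoids)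
  avoids-bc : AllTriples No213 (b ++ (x ∷ c))
  avoids-bc = proj₂ (proj₂ (proj₂ (AllTriples-++⁻ a avoids)))
  avoids-b : AllTriples No213 b
  avoids-b = proj₁ (AllTriples-++⁻ b avoids-bc)
  avoids-c : AllTriples No213 c
  avoids-c = proj₂ (proj₂ (proj₂ (AllTriples-++⁻ b avoids-bc)))

  a≻bc : Exceeds a (b ++ (x ∷ c))
  a≻bc = Exceeds-before-min a _ stirling avoids (above-x range-a x∉a)

  b≻c : Exceeds b c
  b≻c = Exceeds-before-min b c stirling-bc avoids-bc (above-x range-b x∉b)

  top-c top-b : ℕ
  top-c = max x c
  top-b = max top-c b

  x≤top-c : x ≤ top-c
  x≤top-c = ⊥≤max x c
  top-c≤top-b : top-c ≤ top-b
  top-c≤top-b = ⊥≤max top-c b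
  top-b≤hi : top-b ≤ hi
  top-b≤hi = max≤v⁺ (max≤v⁺ lo<hi (All.map proj₂ range-c)) (All.map proj₂ range-b)

  c-range : All (InRange x top-c) c
  c-range = All.zipWith (λ (x<y , y≤top) → x<y , y≤top) (above-x range-c x∉c , xs≤max x c)

  b-range : All (InRange top-c top-b) b
  b-range = All.zipWith (λ ((x<p , c<p) , p≤top) → max<v⁺ x<p c<p , p≤top)
    (All.zip (above-x range-b x∉b , b≻c) , xs≤max top-c b)

  a-range : All (InRange top-b hi) a
  a-range = All.zipWith (λ ((x<p , bc<p) , (_ , p≤hi)) → max<v⁺ (max<v⁺ x<p (All.tail (All.++⁻ʳ b bc<p))) (All.++⁻ˡ b bc<p) , p≤hi)
    (All.zip (above-x range-a x∉a , a≻bc) , range-a)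

  counts : ∀ v → v ≢ x → count v σ ≡ count v a + (count v b + count v c)
  counts v = count-blocks a b c

  x≢ : ∀ {v} → x < v → v ≢ x
  x≢ x<v v≡x = <-irrefl (sym v≡x) x<v

  c-block : Flattenable x top-c c
  c-block = Flattenable-block c F (n≤1+n lo) (≤-trans top-c≤top-b top-b≤hi) c-range
    (λ v (x<v , v≤) → trans (counts v (x≢ x<v)) (cong₂ (λ p q → p + (q + count v c))
      (count-outside a-range (inj₁ (≤-trans v≤ top-c≤top-b))) (count-outside b-range (inj₁ v≤))))
    stirling-c avoids-c

  b-block : Flattenable top-c top-b b
  b-block = Flattenable-block b F (≤-trans (n≤1+n lo) x≤top-c) top-b≤hi b-range
    (λ v (c<v , v≤) → trans (counts v (x≢ (≤-<-trans x≤top-c c<v))) (trans (cong₂ (λ p q → p + (count v b + q))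
      (count-outside a-range (inj₁ v≤)) (count-outside c-range (inj₂ c<v))) (+-identityʳ _)))
    stirling-b avoids-b

  a-block : Flattenable top-b hi a
  a-block = Flattenable-block a F (≤-trans (n≤1+n lo) (≤-trans x≤top-c top-c≤top-b)) ≤-refl a-range
    (λ v (b<v , _) → trans (counts v (x≢ (≤-<-trans (≤-trans x≤top-c top-c≤top-b) b<v)))
      (trans (cong₂ (λ p q → count v a + (p + q)) (count-outside b-range (inj₂ b<v))
        (count-outside c-range (inj₂ (≤-<-trans top-c≤top-b b<v)))) (+-identityʳ _)))
    stirling-a avoids-a

  assemble : Unflattening x top-c c → Unflattening top-c top-b b → Unflattening top-b hi a → Unflattening lo hi σ
  assemble (R , x+R≡ , refl) (M , c+M≡ , refl) (L , b+L≡ , refl) = node L M R , size≡ , flatten≡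
    where
    offset≡ : x + size R + size M ≡ top-b
    offset≡ = trans (cong (_+ size M) x+R≡) c+M≡
    regroup : ∀ lo l m r → lo + suc (l + m + r) ≡ suc lo + r + m + l
    regroup = solve-∀
    size≡ : lo + size (node L M R) ≡ hi
    size≡ = trans (regroup lo (size L) (size M) (size R)) (trans (cong (_+ size L) offset≡) b+L≡)
    flatten≡ : σ ≡ flatten lo (node L M R)
    flatten≡ = cong₂ (λ u w → u ++ (x ∷ w)) (cong (λ k → flatten k L) (sym offset≡))
                 (cong (λ k → flatten k M ++ (x ∷ flatten x R)) (sym x+R≡))

unflatten : ∀ f {lo hi σ} → hi ∸ lo ≤ f → lo ≤ hi → Flattenable lo hi σ → Unflattening lo hi σ
unflatten f {lo} {hi} {σ} width lo≤hi F with hi ≤? lo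
... | yes hi≤lo = leaf , trans (+-identityʳ lo) (≤-antisym lo≤hi hi≤lo) , empty σ (Flattenable.inRange F)
  where
  empty : ∀ σ → All (InRange lo hi) σ → σ ≡ []
  empty []      _                  = refl
  empty (y ∷ σ) ((lo<y , y≤hi) ∷ _) = ⊥-elim (<-irrefl refl (<-≤-trans lo<y (≤-trans y≤hi hi≤lo)))
unflatten zero    width lo≤hi F | no hi≰lo = ⊥-elim (<-irrefl refl (<-≤-trans (m<n⇒0<n∸m (≰⇒> hi≰lo)) width))
unflatten (suc f) {lo} {hi} {σ} width lo≤hi F | no hi≰lo
  with split-at-first (suc lo) σ 1 (Flattenable.twice F (suc lo) (n<1+n lo , ≰⇒> hi≰lo))
... | a , w , refl , x∉a , count-w with split-at-first (suc lo) w 0 count-w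
... | b , c , refl , x∉b , count-c =
  assemble (unflatten f (narrow (n<1+n lo) top-c≤hi) x≤top-c c-block)
           (unflatten f (narrow (<-≤-trans (n<1+n lo) x≤top-c) top-b≤hi) top-c≤top-b b-block)
           (unflatten f (narrow (<-≤-trans (n<1+n lo) (≤-trans x≤top-c top-c≤top-b)) ≤-refl) top-b≤hi a-block)
  where
  open UnflattenNode a b c (≰⇒> hi≰lo) x∉a x∉b (count≡0⇒ (suc lo) c count-c) F
  top-c≤hi : top-c ≤ hi
  top-c≤hi = ≤-trans top-c≤top-b top-b≤hi
  narrow : ∀ {p q} → lo < p → q ≤ hi → q ∸ p ≤ f
  narrow {p} {q} lo<p q≤hi = ≤-trans (∸-mono q≤hi lo<p) (subst (_≤ f) (pred[m∸n]≡m∸[1+n] hi lo) (pred-mono-≤ width))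

++-∷-cancel : ∀ {x} (u w u′ w′ : List ℕ) → All (x ≢_) u → All (x ≢_) u′ → u ++ (x ∷ w) ≡ u′ ++ (x ∷ w′) → u ≡ u′ × w ≡ w′
++-∷-cancel []      w []       w′ _            _            refl = refl , refl
++-∷-cancel []      w (y ∷ u′) w′ _            (x≢y ∷ _)    eq   = ⊥-elim (x≢y (proj₁ (∷-injective eq)))
++-∷-cancel (y ∷ u) w []       w′ (x≢y ∷ _)    _            eq   = ⊥-elim (x≢y (sym (proj₁ (∷-injective eq))))
++-∷-cancel (y ∷ u) w (y′ ∷ u′) w′ (_ ∷ x∉u)   (_ ∷ x∉u′)   eq with ∷-injective eq
... | refl , eq′ with ++-∷-cancel u w u′ w′ x∉u x∉u′ eq′
... | refl , refl = refl , refl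

++-∷-nonempty : ∀ (u : List ℕ) x w → u ++ (x ∷ w) ≢ []
++-∷-nonempty []      x w ()
++-∷-nonempty (y ∷ u) x w ()

flatten-above : ∀ {x o} t → x ≤ o → All (x ≢_) (flatten o t)
flatten-above {o = o} t x≤o = All.map (λ (o<y , _) x≡y → <-irrefl x≡y (≤-<-trans x≤o o<y)) (flatten-range o t)

flatten-injective : ∀ o t t′ → flatten o t ≡ flatten o t′ → t ≡ t′
flatten-injective o leaf         leaf            _  = refl
flatten-injective o leaf         (node L M R)    eq = ⊥-elim (++-∷-nonempty (flatten _ L) _ _ (sym eq))
flatten-injective o (node L M R) leaf            eq = ⊥-elim (++-∷-nonempty (flatten _ L) _ _ eq)
flatten-injective o (node L M R) (node L′ M′ R′) eq
  with ++-∷-cancel (flatten _ L) _ (flatten _ L′) _ (flatten-above L (offset≤ (size R) (size M))) (flatten-above L′ (offset≤ (size R′) (size M′))) eq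
  where
  offset≤ : ∀ r m → suc o ≤ suc o + r + m
  offset≤ r m = ≤-trans (m≤m+n _ r) (m≤m+n _ m)
... | eqL , eqMR with ++-∷-cancel (flatten _ M) _ (flatten _ M′) _ (flatten-above M (m≤m+n (suc o) (size R))) (flatten-above M′ (m≤m+n (suc o) (size R′))) eqMR
... | eqM , eqR with flatten-injective (suc o) R R′ eqR
... | refl with flatten-injective (suc o + size R) M M′ eqM
... | refl with flatten-injective (suc o + size R + size M) L L′ eqL
... | refl = refl

length-flatten : ∀ o t → length (flatten o t) ≡ 2 * size t
length-flatten o leaf         = refl
length-flatten o (node L M R) = begin
  length (fa ++ (suc o ∷ (fb ++ (suc o ∷ fc))))                    ≡⟨ length-++ fa ⟩
  length fa + suc (length (fb ++ (suc o ∷ fc)))                    ≡⟨ cong (λ k → length fa + suc k) (length-++ fb) ⟩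
  length fa + suc (length fb + suc (length fc))
    ≡⟨ cong₃ (λ p q r → p + suc (q + suc r)) (length-flatten _ L) (length-flatten _ M) (length-flatten _ R) ⟩
  2 * size L + suc (2 * size M + suc (2 * size R))                 ≡⟨ regroup (size L) (size M) (size R) ⟩
  2 * size (node L M R)                                            ∎
  where
  open ≡-Reasoning
  fa = flatten (suc o + size R + size M) L
  fb = flatten (suc o + size R) M
  fc = flatten (suc o) R
  regroup : ∀ l m r → 2 * l + suc (2 * m + suc (2 * r)) ≡ 2 * suc (l + m + r)
  regroup = solve-∀

words≡tuples : ∀ n L → words n L ≡ tuples (applyUpTo suc n) L
words≡tuples n zero    = refl
words≡tuples n (suc L) = trans (concatMap-∷ (applyUpTo suc n)) (cong (cartesianProductWith _∷_ (applyUpTo suc n)) (words≡tuples n L))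
  where
  concatMap-∷ : ∀ xs → concatMap (λ x → map (x ∷_) (words n L)) xs ≡ cartesianProductWith _∷_ xs (words n L)
  concatMap-∷ []       = refl
  concatMap-∷ (x ∷ xs) = cong (map (x ∷_) (words n L) ++_) (concatMap-∷ xs)

Q213-unique : ∀ n → Unique (Q213 n)
Q213-unique n = Unique.filter⁺ (inQ213? n) (subst Unique (sym (words≡tuples n (2 * n)))
  (tuples-unique _ (Unique.applyUpTo⁺₁ suc n (λ i<j _ eq → <-irrefl (suc-injective eq) i<j)) (2 * n)))

InRange⇒∈-applyUpTo : ∀ n {y} → InRange 0 n y → y ∈ applyUpTo suc n
InRange⇒∈-applyUpTo n {zero}  (() , _)
InRange⇒∈-applyUpTo n {suc y} (_ , y<n) = ∈-applyUpTo⁺ suc y<n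

∈-applyUpTo⇒InRange : ∀ n {y} → y ∈ applyUpTo suc n → InRange 0 n y
∈-applyUpTo⇒InRange n y∈ with ∈-applyUpTo⁻ suc y∈
... | i , i<n , refl = s≤s z≤n , i<n

flatten∈Q213 : ∀ t → flatten 0 t ∈ Q213 (size t)
flatten∈Q213 t = ∈-filter⁺ (inQ213? (size t)) ∈words (twice , stirling , avoids)
  where
  ∈words : flatten 0 t ∈ words (size t) (2 * size t)
  ∈words = subst (flatten 0 t ∈_) (sym (words≡tuples (size t) (2 * size t)))
             (subst (λ k → flatten 0 t ∈ tuples (applyUpTo suc (size t)) k) (length-flatten 0 t)
               (∈-tuples⁺ _ (All.map (InRange⇒∈-applyUpTo (size t)) (flatten-range 0 t))))
  twice : TwiceEach (size t) (flatten 0 t)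
  twice i = flatten-count 0 t (suc (toℕ i)) (s≤s z≤n , toℕ<n i)
  stirling : StirlingCond (flatten 0 t)
  stirling = AllTriples⇒lookup (flatten-stirling 0 t)
  avoids : Avoids213 (flatten 0 t)
  avoids (a , b , c , a<b , b<c , 213-pattern) = AllTriples⇒lookup (flatten-avoids213 0 t) a b c a<b b<c 213-pattern

Q213⇒flatten : ∀ n {σ} → σ ∈ Q213 n → Σ Tree λ t → size t ≡ n × σ ≡ flatten 0 t
Q213⇒flatten n {σ} σ∈ with ∈-filter⁻ (inQ213? n) {xs = words n (2 * n)} σ∈
... | σ∈words , (twice , stirling , avoids) = unflatten n ≤-refl z≤n (record
  { twice    = λ { (suc v) (_ , v<n) → subst (λ k → count k σ ≡ 2) (cong suc (toℕ-fromℕ< v<n)) (twice (Fin.fromℕ< v<n)) }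
  ; inRange  = All.map (∈-applyUpTo⇒InRange n) (proj₂ (∈-tuples⁻ _ (2 * n) (subst (σ ∈_) (words≡tuples n (2 * n)) σ∈words)))
  ; stirling = lookup⇒AllTriples σ stirling
  ; avoids   = lookup⇒AllTriples σ (λ a b c a<b b<c 213-pattern → avoids (a , b , c , a<b , b<c , 213-pattern))
  })

Q213↭flatten-trees : ∀ n → Q213 n ↭ map (flatten 0) (trees n)
Q213↭flatten-trees n = unique-⇔⇒↭ (Q213-unique n) (Unique.map⁺ (flatten-injective 0 _ _) (trees-unique n)) to from
  where
  to : ∀ {σ} → σ ∈ Q213 n → σ ∈ map (flatten 0) (trees n)
  to σ∈ with Q213⇒flatten n σ∈
  ... | t , refl , refl = ∈-map⁺ (flatten 0) (∈-trees⁺ t)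
  from : ∀ {σ} → σ ∈ map (flatten 0) (trees n) → σ ∈ Q213 n
  from σ∈ with ∈-map⁻ (flatten 0) σ∈
  ... | t , t∈ , refl with ∈-trees⁻ {n} t∈
  ... | refl = flatten∈Q213 t

sum-Q213 : ∀ n (g : List ℕ → ℕ) → sum (map g (Q213 n)) ≡ sum (map (λ t → g (flatten 0 t)) (trees n))
sum-Q213 n g = trans (sum-map-↭ g (Q213↭flatten-trees n)) (sum-map-map g (flatten 0) (trees n))

-- Ascents, descents and plateaux of a flattened tree

sum-map-preorder : ∀ (f : Kind → ℕ) L M R → sum (map f (preorder (node L M R))) ≡
  f (kind (nonempty L) (nonempty M) (nonempty R)) + (sum (map f (preorder L)) + (sum (map f (preorder M)) + sum (map f (preorder R))))
sum-map-preorder f L M R = cong (f _ +_) (trans (cong sum (map-++ f (preorder L) _)) (trans (sum-++ (map f (preorder L)) _)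
  (cong (sum (map f (preorder L)) +_) (trans (cong sum (map-++ f (preorder M) _)) (sum-++ (map f (preorder M)) _)))))

step : (ℕ → ℕ → Bool) → ℕ → ℕ → ℕ
step _∼_ x y = if x ∼ y then 1 else 0

lastStep : (ℕ → ℕ → Bool) → List ℕ → ℕ → ℕ
lastStep _∼_ []          y = 0
lastStep _∼_ (p ∷ [])    y = step _∼_ p y
lastStep _∼_ (p ∷ q ∷ u) y = lastStep _∼_ (q ∷ u) y

firstStep : (ℕ → ℕ → Bool) → ℕ → List ℕ → ℕ
firstStep _∼_ x []      = 0
firstStep _∼_ x (q ∷ _) = step _∼_ x q

countAdj-++-∷ : ∀ _∼_ u y w → countAdj _∼_ (u ++ (y ∷ w)) ≡ countAdj _∼_ u + lastStep _∼_ u y + countAdj _∼_ (y ∷ w)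
countAdj-++-∷ _∼_ []          y w = refl
countAdj-++-∷ _∼_ (p ∷ [])    y w = refl
countAdj-++-∷ _∼_ (p ∷ q ∷ u) y w =
  trans (cong (step _∼_ p q +_) (countAdj-++-∷ _∼_ (q ∷ u) y w)) (regroup (step _∼_ p q) _ _ _)
  where
  regroup : ∀ a b c d → a + (b + c + d) ≡ a + b + c + d
  regroup = solve-∀

lastStep-∷ : ∀ {_∼_} p u y → u ≢ [] → lastStep _∼_ (p ∷ u) y ≡ lastStep _∼_ u y
lastStep-∷ p []      y u≢[] = ⊥-elim (u≢[] refl)
lastStep-∷ p (q ∷ u) y _    = refl

countAdj-∷ : ∀ _∼_ x u → countAdj _∼_ (x ∷ u) ≡ firstStep _∼_ x u + countAdj _∼_ u
countAdj-∷ _∼_ x []      = refl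
countAdj-∷ _∼_ x (q ∷ u) = refl

record StepWeights (_∼_ : ℕ → ℕ → Bool) (down up same : ℕ) : Set where
  field
    step-down : ∀ {x y} → y < x → step _∼_ x y ≡ down
    step-up   : ∀ {x y} → x < y → step _∼_ x y ≡ up
    step-same : ∀ x → step _∼_ x x ≡ same

module FlattenSteps {_∼_ down up same} (weights : StepWeights _∼_ down up same) where

  open StepWeights weights

  lastStep-above : ∀ {x} u → All (x <_) u → u ≢ [] → lastStep _∼_ u x ≡ down
  lastStep-above []          _              u≢[] = ⊥-elim (u≢[] refl)
  lastStep-above (p ∷ [])    (x<p ∷ _)      _    = step-down x<p
  lastStep-above (p ∷ q ∷ u) (_ ∷ x<q∷u)    _    = lastStep-above (q ∷ u) x<q∷u (λ ())

  lastStep-flatten : ∀ {x} o t → All (x <_) (flatten o t) → lastStep _∼_ (flatten o t) x ≡ bool→ℕ (nonempty t) * down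
  lastStep-flatten o leaf         _   = refl
  lastStep-flatten o (node L M R) x<t =
    trans (lastStep-above _ x<t (++-∷-nonempty (flatten _ L) _ _)) (sym (+-identityʳ down))

  firstStep-above : ∀ {x} u → All (x <_) u → u ≢ [] → firstStep _∼_ x u ≡ up
  firstStep-above []      _         u≢[] = ⊥-elim (u≢[] refl)
  firstStep-above (q ∷ u) (x<q ∷ _) _    = step-up x<q

  firstStep-flatten : ∀ {x} o t → All (x <_) (flatten o t) → firstStep _∼_ x (flatten o t) ≡ bool→ℕ (nonempty t) * up
  firstStep-flatten o leaf         _   = refl
  firstStep-flatten o (node L M R) x<t =
    trans (firstStep-above _ x<t (++-∷-nonempty (flatten _ L) _ _)) (sym (+-identityʳ up))

  -- A plateau x x occurs exactly when the middle subtree is empty.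
  lastStep-root : ∀ {x} o t → All (x <_) (flatten o t) →
    lastStep _∼_ (x ∷ flatten o t) x + bool→ℕ (nonempty t) * same ≡ bool→ℕ (nonempty t) * down + same
  lastStep-root o leaf         _   = trans (+-identityʳ _) (step-same _)
  lastStep-root {x} o (node L M R) x<t =
    trans (cong (_+ (same + 0)) (trans (lastStep-∷ x _ x nonempty-flatten) (lastStep-above _ x<t nonempty-flatten))) (swap down same)
    where
    nonempty-flatten : flatten o (node L M R) ≢ []
    nonempty-flatten = ++-∷-nonempty (flatten (suc o + size R + size M) L) _ _
    swap : ∀ d s → d + (s + 0) ≡ d + 0 + s
    swap = solve-∀

  countAdj-flatten-node : ∀ o L M R →
    countAdj _∼_ (flatten o (node L M R)) + bool→ℕ (nonempty M) * same ≡
    countAdj _∼_ (flatten (suc o + size R + size M) L) + countAdj _∼_ (flatten (suc o + size R) M) + countAdj _∼_ (flatten (suc o) R)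
      + (bool→ℕ (nonempty L) * down + bool→ℕ (nonempty M) * (up + down) + bool→ℕ (nonempty R) * up + same)
  countAdj-flatten-node o L M R = begin
    countAdj _∼_ (fa ++ (x ∷ (fb ++ (x ∷ fc)))) + [M] * same
      ≡⟨ cong (_+ [M] * same) (countAdj-++-∷ _∼_ fa x _) ⟩
    countAdj _∼_ fa + lastStep _∼_ fa x + countAdj _∼_ ((x ∷ fb) ++ (x ∷ fc)) + [M] * same
      ≡⟨ cong (λ k → countAdj _∼_ fa + lastStep _∼_ fa x + k + [M] * same) (countAdj-++-∷ _∼_ (x ∷ fb) x fc) ⟩
    countAdj _∼_ fa + lastStep _∼_ fa x + (countAdj _∼_ (x ∷ fb) + lastStep _∼_ (x ∷ fb) x + countAdj _∼_ (x ∷ fc)) + [M] * same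
      ≡⟨ cong₂ (λ u v → countAdj _∼_ fa + lastStep _∼_ fa x + (u + lastStep _∼_ (x ∷ fb) x + v) + [M] * same)
               (countAdj-∷ _∼_ x fb) (countAdj-∷ _∼_ x fc) ⟩
    countAdj _∼_ fa + lastStep _∼_ fa x + (firstStep _∼_ x fb + countAdj _∼_ fb + lastStep _∼_ (x ∷ fb) x
      + (firstStep _∼_ x fc + countAdj _∼_ fc)) + [M] * same
      ≡⟨ regroup (countAdj _∼_ fa) (lastStep _∼_ fa x) (firstStep _∼_ x fb) (countAdj _∼_ fb) (lastStep _∼_ (x ∷ fb) x)
                 (firstStep _∼_ x fc) (countAdj _∼_ fc) ([M] * same) ⟩
    countAdj _∼_ fa + countAdj _∼_ fb + countAdj _∼_ fc
      + (lastStep _∼_ fa x + firstStep _∼_ x fb + (lastStep _∼_ (x ∷ fb) x + [M] * same) + firstStep _∼_ x fc)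
      ≡⟨ cong (countAdj _∼_ fa + countAdj _∼_ fb + countAdj _∼_ fc +_)
           (cong₃ (λ p q r → p + q + r + firstStep _∼_ x fc) (lastStep-flatten _ L root<a) (firstStep-flatten _ M root<b)
                  (lastStep-root _ M root<b)) ⟩
    countAdj _∼_ fa + countAdj _∼_ fb + countAdj _∼_ fc
      + ([L] * down + [M] * up + ([M] * down + same) + firstStep _∼_ x fc)
      ≡⟨ cong (λ k → countAdj _∼_ fa + countAdj _∼_ fb + countAdj _∼_ fc + ([L] * down + [M] * up + ([M] * down + same) + k))
              (firstStep-flatten _ R root<c) ⟩
    countAdj _∼_ fa + countAdj _∼_ fb + countAdj _∼_ fc
      + ([L] * down + [M] * up + ([M] * down + same) + [R] * up)
      ≡⟨ cong (countAdj _∼_ fa + countAdj _∼_ fb + countAdj _∼_ fc +_) (collect [L] [M] [R] down up same) ⟩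
    countAdj _∼_ fa + countAdj _∼_ fb + countAdj _∼_ fc
      + ([L] * down + [M] * (up + down) + [R] * up + same) ∎
    where
    open ≡-Reasoning
    open NodeBlocks (flatten-blocks o L M R)
    x = suc o
    fa = flatten (suc o + size R + size M) L
    fb = flatten (suc o + size R) M
    fc = flatten (suc o) R
    [L] = bool→ℕ (nonempty L)
    [M] = bool→ℕ (nonempty M)
    [R] = bool→ℕ (nonempty R)
    regroup : ∀ a eA hB b eB hC c s →
      a + eA + (hB + b + eB + (hC + c)) + s ≡ a + b + c + (eA + hB + (eB + s) + hC)
    regroup = solve-∀
    collect : ∀ l m r d u s → l * d + m * u + (m * d + s) + r * u ≡ l * d + m * (u + d) + r * u + s
    collect = solve-∀

step-yes : ∀ _∼_ x y → T (x ∼ y) → step _∼_ x y ≡ 1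
step-yes _∼_ x y holds with x ∼ y
... | true = refl

step-no : ∀ _∼_ x y → ¬ T (x ∼ y) → step _∼_ x y ≡ 0
step-no _∼_ x y fails with x ∼ y
... | true  = ⊥-elim (fails tt)
... | false = refl

ascWeights : StepWeights _<ᵇ_ 0 1 0
ascWeights = record
  { step-down = λ {x} {y} y<x → step-no _<ᵇ_ x y (λ x<ᵇy → <-asym y<x (<ᵇ⇒< x y x<ᵇy))
  ; step-up   = λ {x} {y} x<y → step-yes _<ᵇ_ x y (<⇒<ᵇ x<y)
  ; step-same = λ x → step-no _<ᵇ_ x x (λ x<ᵇx → <-irrefl refl (<ᵇ⇒< x x x<ᵇx))
  }

desWeights : StepWeights (λ x y → y <ᵇ x) 1 0 0
desWeights = record
  { step-down = λ {x} {y} y<x → step-yes (λ x y → y <ᵇ x) x y (<⇒<ᵇ y<x)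
  ; step-up   = λ {x} {y} x<y → step-no (λ x y → y <ᵇ x) x y (λ y<ᵇx → <-asym x<y (<ᵇ⇒< y x y<ᵇx))
  ; step-same = λ x → step-no (λ x y → y <ᵇ x) x x (λ x<ᵇx → <-irrefl refl (<ᵇ⇒< x x x<ᵇx))
  }

platWeights : StepWeights _≡ᵇ_ 0 0 1
platWeights = record
  { step-down = λ {x} {y} y<x → step-no _≡ᵇ_ x y (λ x≡ᵇy → <-irrefl (sym (≡ᵇ⇒≡ x y x≡ᵇy)) y<x)
  ; step-up   = λ {x} {y} x<y → step-no _≡ᵇ_ x y (λ x≡ᵇy → <-irrefl (≡ᵇ⇒≡ x y x≡ᵇy) x<y)
  ; step-same = λ x → step-yes _≡ᵇ_ x x (≡⇒≡ᵇ x x refl)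
  }

private
  n≡n+m*0 : ∀ n m → n ≡ n + m * 0
  n≡n+m*0 = solve-∀

asc-flatten : ∀ o t → asc (flatten o t) ≡ middles (preorder t) + rights (preorder t)
asc-flatten o leaf         = refl
asc-flatten o (node L M R) = begin
  asc (flatten o (node L M R))                                        ≡⟨ n≡n+m*0 _ (bool→ℕ (nonempty M)) ⟩
  asc (flatten o (node L M R)) + bool→ℕ (nonempty M) * 0              ≡⟨ FlattenSteps.countAdj-flatten-node ascWeights o L M R ⟩
  asc fa + asc fb + asc fc + ([L] * 0 + [M] * (1 + 0) + [R] * 1 + 0)
    ≡⟨ cong₃ (λ p q r → p + q + r + ([L] * 0 + [M] * (1 + 0) + [R] * 1 + 0)) (asc-flatten _ L) (asc-flatten _ M) (asc-flatten _ R) ⟩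
  (mL + rL) + (mM + rM) + (mR + rR) + ([L] * 0 + [M] * (1 + 0) + [R] * 1 + 0)
    ≡⟨ regroup [L] [M] [R] mL mM mR rL rM rR ⟩
  ([M] + (mL + (mM + mR))) + ([R] + (rL + (rM + rR)))
    ≡⟨ cong₂ _+_ (sum-map-preorder hasMiddle L M R) (sum-map-preorder hasRight L M R) ⟨
  middles (preorder (node L M R)) + rights (preorder (node L M R)) ∎
  where
  open ≡-Reasoning
  fa = flatten (suc o + size R + size M) L
  fb = flatten (suc o + size R) M
  fc = flatten (suc o) R
  [L] = bool→ℕ (nonempty L)
  [M] = bool→ℕ (nonempty M)
  [R] = bool→ℕ (nonempty R)
  mL = middles (preorder L) ; mM = middles (preorder M) ; mR = middles (preorder R)
  rL = rights (preorder L) ; rM = rights (preorder M) ; rR = rights (preorder R)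
  regroup : ∀ l m r mL mM mR rL rM rR → (mL + rL) + (mM + rM) + (mR + rR) + (l * 0 + m * (1 + 0) + r * 1 + 0)
    ≡ (m + (mL + (mM + mR))) + (r + (rL + (rM + rR)))
  regroup = solve-∀

des-flatten : ∀ o t → des (flatten o t) ≡ lefts (preorder t) + middles (preorder t)
des-flatten o leaf         = refl
des-flatten o (node L M R) = begin
  des (flatten o (node L M R))                                        ≡⟨ n≡n+m*0 _ (bool→ℕ (nonempty M)) ⟩
  des (flatten o (node L M R)) + bool→ℕ (nonempty M) * 0              ≡⟨ FlattenSteps.countAdj-flatten-node desWeights o L M R ⟩
  des fa + des fb + des fc + ([L] * 1 + [M] * (0 + 1) + [R] * 0 + 0)
    ≡⟨ cong₃ (λ p q r → p + q + r + ([L] * 1 + [M] * (0 + 1) + [R] * 0 + 0)) (des-flatten _ L) (des-flatten _ M) (des-flatten _ R) ⟩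
  (lL + mL) + (lM + mM) + (lR + mR) + ([L] * 1 + [M] * (0 + 1) + [R] * 0 + 0)
    ≡⟨ regroup [L] [M] [R] lL lM lR mL mM mR ⟩
  ([L] + (lL + (lM + lR))) + ([M] + (mL + (mM + mR)))
    ≡⟨ cong₂ _+_ (sum-map-preorder hasLeft L M R) (sum-map-preorder hasMiddle L M R) ⟨
  lefts (preorder (node L M R)) + middles (preorder (node L M R)) ∎
  where
  open ≡-Reasoning
  fa = flatten (suc o + size R + size M) L
  fb = flatten (suc o + size R) M
  fc = flatten (suc o) R
  [L] = bool→ℕ (nonempty L)
  [M] = bool→ℕ (nonempty M)
  [R] = bool→ℕ (nonempty R)
  lL = lefts (preorder L) ; lM = lefts (preorder M) ; lR = lefts (preorder R)
  mL = middles (preorder L) ; mM = middles (preorder M) ; mR = middles (preorder R)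
  regroup : ∀ l m r lL lM lR mL mM mR → (lL + mL) + (lM + mM) + (lR + mR) + (l * 1 + m * (0 + 1) + r * 0 + 0)
    ≡ (l + (lL + (lM + lR))) + (m + (mL + (mM + mR)))
  regroup = solve-∀

plat-flatten : ∀ o t → plat (flatten o t) + middles (preorder t) ≡ size t
plat-flatten o leaf         = refl
plat-flatten o (node L M R) = begin
  plat (flatten o (node L M R)) + middles (preorder (node L M R))
    ≡⟨ cong (plat (flatten o (node L M R)) +_) (sum-map-preorder hasMiddle L M R) ⟩
  plat (flatten o (node L M R)) + ([M] + (mL + (mM + mR)))
    ≡⟨ split-off (plat (flatten o (node L M R))) [M] mL mM mR ⟩
  plat (flatten o (node L M R)) + [M] * 1 + (mL + (mM + mR))
    ≡⟨ cong (_+ (mL + (mM + mR))) (FlattenSteps.countAdj-flatten-node platWeights o L M R) ⟩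
  plat fa + plat fb + plat fc + ([L] * 0 + [M] * (0 + 0) + [R] * 0 + 1) + (mL + (mM + mR))
    ≡⟨ regroup [L] [M] [R] (plat fa) (plat fb) (plat fc) mL mM mR ⟩
  suc ((plat fa + mL) + (plat fb + mM) + (plat fc + mR))
    ≡⟨ cong₃ (λ p q r → suc (p + q + r)) (plat-flatten _ L) (plat-flatten _ M) (plat-flatten _ R) ⟩
  size (node L M R) ∎
  where
  open ≡-Reasoning
  fa = flatten (suc o + size R + size M) L
  fb = flatten (suc o + size R) M
  fc = flatten (suc o) R
  [L] = bool→ℕ (nonempty L)
  [M] = bool→ℕ (nonempty M)
  [R] = bool→ℕ (nonempty R)
  mL = middles (preorder L) ; mM = middles (preorder M) ; mR = middles (preorder R)
  split-off : ∀ p m mL mM mR → p + (m + (mL + (mM + mR))) ≡ p + m * 1 + (mL + (mM + mR))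
  split-off = solve-∀
  regroup : ∀ l m r pL pM pR mL mM mR → pL + pM + pR + (l * 0 + m * (0 + 0) + r * 0 + 1) + (mL + (mM + mR))
    ≡ suc ((pL + mL) + (pM + mM) + (pR + mR))
  regroup = solve-∀

-- The joint distribution of ascents, descents and plateaux

matches : ℕ → ℕ → ℕ → ℕ → ℕ → ℕ → ℕ
matches m d k x y z = if does ((x ≟ m) ×-dec (y ≟ d) ×-dec (z ≟ k)) then 1 else 0

indicator-⇔ : ∀ {P Q : Set} (p : Dec P) (q : Dec Q) → (P → Q) → (Q → P) → (if does p then 1 else 0) ≡ (if does q then 1 else 0)
indicator-⇔ (yes _) (yes _) _   _   = refl
indicator-⇔ (yes p) (no ¬q) P→Q _   = ⊥-elim (¬q (P→Q p))
indicator-⇔ (no ¬p) (yes q) _   Q→P = ⊥-elim (¬p (Q→P q))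
indicator-⇔ (no _)  (no _)  _   _   = refl

indicator-no : ∀ {P : Set} (p : Dec P) → ¬ P → (if does p then 1 else 0) ≡ 0
indicator-no (yes p) ¬p = ⊥-elim (¬p p)
indicator-no (no _)  _  = refl

matches-no : ∀ {m d k x y z} → ¬ (x ≡ m × y ≡ d × z ≡ k) → matches m d k x y z ≡ 0
matches-no {m} {d} {k} {x} {y} {z} = indicator-no ((x ≟ m) ×-dec (y ≟ d) ×-dec (z ≟ k))

ifEq³≡matches : ∀ a b c a₀ b₀ c₀ → ifEq a a₀ (ifEq b b₀ (ifEq c c₀ 1)) ≡ matches a₀ b₀ c₀ a b c
ifEq³≡matches a b c a₀ b₀ c₀ with a ≡ᵇ a₀ | b ≡ᵇ b₀ | c ≡ᵇ c₀
... | true  | true  | true  = refl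
... | true  | true  | false = refl
... | true  | false | _     = refl
... | false | _     | _     = refl

-- A forest word's ascents, descents and plateaux, as read off its flattening.
wordMatches : ℕ → ℕ → ℕ → ℕ → List Kind → ℕ
wordMatches n m d k κs =
  if isForest 1 κs then matches m d k (middles κs + rights κs) (lefts κs + middles κs) (n ∸ middles κs) else 0

plat-flatten-tree : ∀ t → plat (flatten 0 t) ≡ size t ∸ middles (preorder t)
plat-flatten-tree t = trans (sym (m+n∸n≡m _ (middles (preorder t)))) (cong (_∸ middles (preorder t)) (plat-flatten 0 t))

N213≡sum-wordMatches : ∀ n → 1 ≤ n → ∀ m d k → N213 n m d k ≡ sum (map (wordMatches n m d k) (kindWords n))
N213≡sum-wordMatches n 1≤n m d k = begin
  N213 n m d k
    ≡⟨ length-filter-sum _ (Q213 n) ⟩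
  sum (map (λ σ → matches m d k (asc σ) (des σ) (plat σ)) (Q213 n))
    ≡⟨ sum-Q213 n (λ σ → matches m d k (asc σ) (des σ) (plat σ)) ⟩
  sum (map (λ t → matches m d k (asc (flatten 0 t)) (des (flatten 0 t)) (plat (flatten 0 t))) (trees n))
    ≡⟨ sum-map-cong (trees n) (λ t t∈ → cong₃ (matches m d k) (asc-flatten 0 t) (des-flatten 0 t)
         (trans (plat-flatten-tree t) (cong (_∸ middles (preorder t)) (∈-trees⁻ {n} t∈)))) ⟩
  sum (map (λ t → matches m d k (middles (preorder t) + rights (preorder t)) (lefts (preorder t) + middles (preorder t))
                                (n ∸ middles (preorder t))) (trees n))
    ≡⟨ sum-trees n 1≤n (λ κs → matches m d k (middles κs + rights κs) (lefts κs + middles κs) (n ∸ middles κs)) ⟩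
  sum (map (wordMatches n m d k) (kindWords n)) ∎
  where open ≡-Reasoning

N213-vanishes : ∀ n → 1 ≤ n → ∀ m d k →
  (∀ κs → κs ∈ kindWords n → isForest 1 κs ≡ true → ¬ (middles κs + rights κs ≡ m × lefts κs + middles κs ≡ d × n ∸ middles κs ≡ k)) →
  N213 n m d k ≡ 0
N213-vanishes n 1≤n m d k no-word = trans (N213≡sum-wordMatches n 1≤n m d k) (sum-map-0 (kindWords n) vanish)
  where
  vanish : ∀ κs → κs ∈ kindWords n → wordMatches n m d k κs ≡ 0
  vanish κs κs∈ with isForest 1 κs in valid
  ... | true  = matches-no (no-word κs κs∈ valid)
  ... | false = refl

stats-sum : ∀ n a b c → 1 + a + b + c ≡ n → 2 * n ∸ 1 ≡ (b + c) + (a + b) + (n ∸ b)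
stats-sum .(suc (a + b + c)) a b c refl =
  trans (cong (_∸ 1) (double-count a b c))
        (cong ((b + c) + (a + b) +_) (sym (trans (cong (_∸ b) (move-b a b c)) (m+n∸n≡m (suc (a + c)) b))))
  where
  double-count : ∀ a b c → suc (a + b + c) + (suc (a + b + c) + 0) ≡ suc ((b + c) + (a + b) + suc (a + c))
  double-count = solve-∀
  move-b : ∀ a b c → suc (a + b + c) ≡ suc (a + c) + b
  move-b = solve-∀

N213-off-diagonal : ∀ n → 1 ≤ n → ∀ m d k → ¬ (2 * n ∸ 1 ≡ m + d + k) → N213 n m d k ≡ 0
N213-off-diagonal n 1≤n m d k off = N213-vanishes n 1≤n m d k (λ κs κs∈ valid (m≡ , d≡ , k≡) →
  off (trans (stats-sum n (lefts κs) (middles κs) (rights κs) (forestWord-size κs∈ valid)) (cong₃ (λ x y z → x + y + z) m≡ d≡ k≡)))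

middle-determined : ∀ {n k b b₀} → b₀ + k ≡ n → b ≤ n → n ∸ b ≡ k → b ≡ b₀
middle-determined {n} {k} {b} {b₀} b₀+k≡n b≤n n∸b≡k =
  +-cancelʳ-≡ k b b₀ (trans (+-comm b k) (trans (cong (_+ b) (sym n∸b≡k)) (trans (m∸n+n≡m b≤n) (sym b₀+k≡n))))

module StatsDetermineCounts {n m d k a₀ b₀ c₀} (b₀+k≡n : b₀ + k ≡ n) (b₀+c₀≡m : b₀ + c₀ ≡ m) (b₀+a₀≡d : b₀ + a₀ ≡ d) where

  stats⇒counts : ∀ {a b c} → b ≤ n → b + c ≡ m × a + b ≡ d × n ∸ b ≡ k → a ≡ a₀ × b ≡ b₀ × c ≡ c₀
  stats⇒counts {a} {b} {c} b≤n (m≡ , d≡ , k≡) with middle-determined {b₀ = b₀} b₀+k≡n b≤n k≡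
  ... | refl = +-cancelʳ-≡ b₀ a a₀ (trans d≡ (trans (sym b₀+a₀≡d) (+-comm b₀ a₀))) , refl ,
               +-cancelˡ-≡ b₀ c c₀ (trans m≡ (sym b₀+c₀≡m))

  counts⇒stats : ∀ {a b c} → a ≡ a₀ × b ≡ b₀ × c ≡ c₀ → b + c ≡ m × a + b ≡ d × n ∸ b ≡ k
  counts⇒stats (refl , refl , refl) =
    b₀+c₀≡m , trans (+-comm a₀ b₀) b₀+a₀≡d , trans (cong (_∸ b₀) (sym b₀+k≡n)) (m+n∸m≡n b₀ k)

middles≤ : ∀ {n κs} → κs ∈ kindWords n → isForest 1 κs ≡ true → middles κs ≤ n
middles≤ {n} {κs} κs∈ valid = subst (middles κs ≤_) (forestWord-size κs∈ valid) (≤-trans (m≤n+m _ (1 + lefts κs)) (m≤m+n _ (rights κs)))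

C≡0 : ∀ {n k} → n < k → n C k ≡ 0
C≡0 {n} {k} n<k = trans (sym (binom≡C n k)) (binom-> n<k)

∸1-+1 : ∀ n s → 1 ≤ n → 2 * n ∸ 1 ≡ s → s + 1 ≡ n + n
∸1-+1 (suc n) s _ refl = shape n
  where
  shape : ∀ n → n + suc (n + 0) + 1 ≡ suc n + suc n
  shape = solve-∀

module Diagonal (n m d k : ℕ) (1≤n : 1 ≤ n) (diag : 2 * n ∸ 1 ≡ m + d + k) where

  RHS : ℕ
  RHS = (n C (m + 1)) * (n C (d + 1)) * (n C k)

  vanishing : (∀ κs → κs ∈ kindWords n → isForest 1 κs ≡ true →
    ¬ (middles κs + rights κs ≡ m × lefts κs + middles κs ≡ d × n ∸ middles κs ≡ k)) → n * N213 n m d k ≡ 0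
  vanishing no-word = trans (cong (n *_) (N213-vanishes n 1≤n m d k no-word)) (*-zeroʳ n)

  total : m + d + k + 1 ≡ n + n
  total = ∸1-+1 n (m + d + k) 1≤n diag

  -- With m + d + k + 1 = 2n and b₀ + k = n, an outer statistic below b₀ pushes the other one past n.
  outer-too-large : ∀ {m′ d′ b₀} → m′ + d′ + k + 1 ≡ n + n → b₀ + k ≡ n → m′ < b₀ → n < d′ + 1
  outer-too-large {m′} {d′} {b₀} total′ b₀+k≡n m′<b₀ = ≰⇒> λ d′+1≤n → <-irrefl balance (+-mono-<-≤ m′<b₀ d′+1≤n)
    where
    shift-1 : ∀ m d k → m + d + k + 1 ≡ m + (d + 1) + k
    shift-1 = solve-∀
    regroup : ∀ b₀ k n → n + (b₀ + k) ≡ b₀ + n + k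
    regroup = solve-∀
    balance : m′ + (d′ + 1) ≡ b₀ + n
    balance = +-cancelʳ-≡ k _ _ (trans (sym (shift-1 m′ d′ k)) (trans total′ (trans (cong (n +_) (sym b₀+k≡n)) (regroup b₀ k n))))

  plateaux-too-many : ¬ k ≤ n → n * N213 n m d k ≡ RHS
  plateaux-too-many k≰n = trans (vanishing (λ κs _ _ (_ , _ , k≡) → k≰n (subst (_≤ n) k≡ (m∸n≤m n (middles κs)))))
    (sym (trans (cong ((n C (m + 1)) * (n C (d + 1)) *_) (C≡0 (≰⇒> k≰n))) (*-zeroʳ ((n C (m + 1)) * (n C (d + 1))))))

  module _ (k≤n : k ≤ n) where

    b₀ : ℕ
    b₀ = n ∸ k
    b₀+k≡n : b₀ + k ≡ n
    b₀+k≡n = m∸n+n≡m k≤n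

    b≡b₀ : ∀ {κs} → κs ∈ kindWords n → isForest 1 κs ≡ true → n ∸ middles κs ≡ k → middles κs ≡ b₀
    b≡b₀ κs∈ valid = middle-determined {b₀ = b₀} b₀+k≡n (middles≤ κs∈ valid)

    ascents-too-few : ¬ b₀ ≤ m → n * N213 n m d k ≡ RHS
    ascents-too-few b₀≰m = trans
      (vanishing (λ κs κs∈ valid (m≡ , _ , k≡) → b₀≰m (subst (_≤ m) (b≡b₀ κs∈ valid k≡) (subst (middles κs ≤_) m≡ (m≤m+n _ (rights κs))))))
      (sym (trans (cong (λ u → (n C (m + 1)) * u * (n C k)) (C≡0 (outer-too-large total b₀+k≡n (≰⇒> b₀≰m))))
                  (cong (_* (n C k)) (*-zeroʳ (n C (m + 1))))))

    descents-too-few : ¬ b₀ ≤ d → n * N213 n m d k ≡ RHS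
    descents-too-few b₀≰d = trans
      (vanishing (λ κs κs∈ valid (_ , d≡ , k≡) → b₀≰d (subst (_≤ d) (b≡b₀ κs∈ valid k≡) (subst (middles κs ≤_) d≡ (m≤n+m _ (lefts κs))))))
      (sym (cong (λ u → u * (n C (d + 1)) * (n C k))
        (C≡0 (outer-too-large (trans (cong (λ u → u + k + 1) (+-comm d m)) total) b₀+k≡n (≰⇒> b₀≰d)))))

    module _ (b₀≤m : b₀ ≤ m) (b₀≤d : b₀ ≤ d) where

      a₀ c₀ : ℕ
      a₀ = d ∸ b₀
      c₀ = m ∸ b₀
      b₀+c₀≡m : b₀ + c₀ ≡ m
      b₀+c₀≡m = m+[n∸m]≡n b₀≤m
      b₀+a₀≡d : b₀ + a₀ ≡ d
      b₀+a₀≡d = m+[n∸m]≡n b₀≤d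

      open StatsDetermineCounts {n} {m} {d} {k} {a₀} {b₀} {c₀} b₀+k≡n b₀+c₀≡m b₀+a₀≡d

      counts-size : 1 + a₀ + b₀ + c₀ ≡ n
      counts-size = +-cancelʳ-≡ n (1 + a₀ + b₀ + c₀) n (trans (cong ((1 + a₀ + b₀ + c₀) +_) (sym b₀+k≡n))
        (trans (regroup a₀ b₀ c₀ k) (trans (cong₂ (λ u v → u + v + k + 1) b₀+c₀≡m b₀+a₀≡d) total)))
        where
        regroup : ∀ a₀ b₀ c₀ k → 1 + a₀ + b₀ + c₀ + (b₀ + k) ≡ (b₀ + c₀) + (b₀ + a₀) + k + 1
        regroup = solve-∀

      wordMatches≡forestIndicator : ∀ κs → κs ∈ kindWords n → wordMatches n m d k κs ≡ forestIndicator 1 a₀ b₀ c₀ κs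
      wordMatches≡forestIndicator κs κs∈ with isForest 1 κs in valid
      ... | false = sym (ifEq³-0 (lefts κs) (middles κs) (rights κs) a₀ b₀ c₀)
      ... | true  = trans (indicator-⇔ stats? counts? (stats⇒counts (middles≤ κs∈ valid)) counts⇒stats)
                          (sym (ifEq³≡matches (lefts κs) (middles κs) (rights κs) a₀ b₀ c₀))
        where
        stats? : Dec (middles κs + rights κs ≡ m × lefts κs + middles κs ≡ d × n ∸ middles κs ≡ k)
        stats? = (middles κs + rights κs ≟ m) ×-dec (lefts κs + middles κs ≟ d) ×-dec (n ∸ middles κs ≟ k)
        counts? : Dec (lefts κs ≡ a₀ × middles κs ≡ b₀ × rights κs ≡ c₀)
        counts? = (lefts κs ≟ a₀) ×-dec (middles κs ≟ b₀) ×-dec (rights κs ≟ c₀)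

      main : n * N213 n m d k ≡ RHS
      main = begin
        n * N213 n m d k
          ≡⟨ cong (n *_) (trans (N213≡sum-wordMatches n 1≤n m d k) (sum-map-cong (kindWords n) wordMatches≡forestIndicator)) ⟩
        n * forestCount 1 n a₀ b₀ c₀
          ≡⟨ forestFormula n 1 a₀ b₀ c₀ counts-size ⟩
        1 * (binom n a₀ * binom n b₀ * binom n c₀)
          ≡⟨ *-identityˡ _ ⟩
        binom n a₀ * binom n b₀ * binom n c₀
          ≡⟨ cong₃ (λ x y z → x * y * z) (binom-sym a₀ (m + 1) a₀+m+1≡n) (binom-sym b₀ k b₀+k≡n) (binom-sym c₀ (d + 1) c₀+d+1≡n) ⟩
        binom n (m + 1) * binom n k * binom n (d + 1)
          ≡⟨ swap-last (binom n (m + 1)) (binom n k) (binom n (d + 1)) ⟩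
        binom n (m + 1) * binom n (d + 1) * binom n k
          ≡⟨ cong₃ (λ x y z → x * y * z) (binom≡C n (m + 1)) (binom≡C n (d + 1)) (binom≡C n k) ⟩
        RHS ∎
        where
        open ≡-Reasoning
        swap-last : ∀ x y z → x * y * z ≡ x * z * y
        swap-last = solve-∀
        regroup : ∀ a₀ b₀ c₀ → a₀ + ((b₀ + c₀) + 1) ≡ 1 + a₀ + b₀ + c₀
        regroup = solve-∀
        regroup′ : ∀ a₀ b₀ c₀ → c₀ + ((b₀ + a₀) + 1) ≡ 1 + a₀ + b₀ + c₀
        regroup′ = solve-∀
        a₀+m+1≡n : a₀ + (m + 1) ≡ n
        a₀+m+1≡n = trans (cong (λ u → a₀ + (u + 1)) (sym b₀+c₀≡m)) (trans (regroup a₀ b₀ c₀) counts-size)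
        c₀+d+1≡n : c₀ + (d + 1) ≡ n
        c₀+d+1≡n = trans (cong (λ u → c₀ + (u + 1)) (sym b₀+a₀≡d)) (trans (regroup′ a₀ b₀ c₀) counts-size)

N213-diagonal : ∀ n → 1 ≤ n → ∀ m d k → 2 * n ∸ 1 ≡ m + d + k → n * N213 n m d k ≡ (n C (m + 1)) * (n C (d + 1)) * (n C k)
N213-diagonal n 1≤n m d k diag with k ≤? n
... | no k≰n = plateaux-too-many k≰n
  where open Diagonal n m d k 1≤n diag
... | yes k≤n with n ∸ k ≤? m | n ∸ k ≤? d
...   | no b₀≰m  | _         = ascents-too-few k≤n b₀≰m
  where open Diagonal n m d k 1≤n diag
...   | yes _    | no b₀≰d   = descents-too-few k≤n b₀≰d
  where open Diagonal n m d k 1≤n diag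
...   | yes b₀≤m | yes b₀≤d  = main k≤n b₀≤m b₀≤d
  where open Diagonal n m d k 1≤n diag

-- The plateau polynomial

sum-ifEq : ∀ (xs : List ℕ) x (F w : ℕ → ℕ) → Unique xs → x ∈ xs → sum (map (λ i → ifEq x i (F i) * w i) xs) ≡ F x * w x
sum-ifEq (i ∷ xs) x F w (i∉ ∷ xs!) (here refl) =
  trans (cong₂ _+_ (cong (_* w x) (ifEq-yes x x (F x) refl))
                   (sum-map-0 xs (λ j j∈ → cong (_* w j) (ifEq-no x j (F j) (All.lookup i∉ j∈)))))
        (+-identityʳ _)
sum-ifEq (i ∷ xs) x F w (i∉ ∷ xs!) (there x∈) =
  trans (cong (_+ sum (map (λ i → ifEq x i (F i) * w i) xs)) (cong (_* w i) (ifEq-no x i (F i) (λ { refl → All.lookup i∉ x∈ refl }))))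
        (sum-ifEq xs x F w xs! x∈)

plateauWeight-split : ∀ n p κs → κs ∈ kindWords n →
  (if isForest 1 κs then p ^ (n ∸ middles κs) else 0) ≡ sum (map (λ i → forestIndicator₂ 1 i (n ∸ 1 ∸ i) κs * p ^ (n ∸ i)) (upTo n))
plateauWeight-split n p κs κs∈ with isForest 1 κs in valid
... | false = sym (sum-map-0 (upTo n) (λ i _ →
  cong (_* p ^ (n ∸ i)) (trans (cong (ifEq (middles κs) i) (ifEq-0 (lefts κs + rights κs) (n ∸ 1 ∸ i))) (ifEq-0 (middles κs) i))))
... | true = sym (trans (sum-ifEq (upTo n) (middles κs) (λ i → ifEq (lefts κs + rights κs) (n ∸ 1 ∸ i) 1) (λ i → p ^ (n ∸ i))
                         (Unique.upTo⁺ n) (∈-upTo⁺ middles<n))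
                       (trans (cong (_* p ^ (n ∸ middles κs)) (ifEq-yes (lefts κs + rights κs) (n ∸ 1 ∸ middles κs) 1 outer≡)) (*-identityˡ _)))
  where
  a = lefts κs
  b = middles κs
  c = rights κs
  size≡ : 1 + a + b + c ≡ n
  size≡ = forestWord-size κs∈ valid
  middles<n : b < n
  middles<n = subst (b <_) size≡ (s≤s (≤-trans (m≤n+m b a) (m≤m+n _ c)))
  outer≡ : a + c ≡ n ∸ 1 ∸ b
  outer≡ = sym (subst (λ k → k ∸ 1 ∸ b ≡ a + c) size≡ (trans (cong (_∸ b) (regroup a b c)) (m+n∸n≡m (a + c) b)))
    where
    regroup : ∀ a b c → a + b + c ≡ (a + c) + b
    regroup = solve-∀

1+i+[n∸1∸i]≡n : ∀ {n i} → i < n → 1 + i + (n ∸ 1 ∸ i) ≡ n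
1+i+[n∸1∸i]≡n {suc n} (s≤s i≤n) = cong suc (m+[n∸m]≡n i≤n)

plateau-formula : ∀ n → 1 ≤ n → ∀ p → n * sum (map (λ σ → p ^ plat σ) (Q213 n))
  ≡ sum (map (λ i → (n C i) * ((2 * n) C (n ∸ 1 ∸ i)) * p ^ (n ∸ i)) (upTo n))
plateau-formula n 1≤n p = begin
  n * sum (map (λ σ → p ^ plat σ) (Q213 n))
    ≡⟨ cong (n *_) (sum-Q213 n (λ σ → p ^ plat σ)) ⟩
  n * sum (map (λ t → p ^ plat (flatten 0 t)) (trees n))
    ≡⟨ cong (n *_) (sum-map-cong (trees n) (λ t t∈ → cong (p ^_) (trans (plat-flatten-tree t) (cong (_∸ middles (preorder t)) (∈-trees⁻ {n} t∈))))) ⟩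
  n * sum (map (λ t → p ^ (n ∸ middles (preorder t))) (trees n))
    ≡⟨ cong (n *_) (sum-trees n 1≤n (λ κs → p ^ (n ∸ middles κs))) ⟩
  n * sum (map (λ κs → if isForest 1 κs then p ^ (n ∸ middles κs) else 0) (kindWords n))
    ≡⟨ cong (n *_) (sum-map-cong (kindWords n) (λ κs κs∈ → plateauWeight-split n p κs κs∈)) ⟩
  n * sum (map (λ κs → sum (map (λ i → term i κs) (upTo n))) (kindWords n))
    ≡⟨ cong (n *_) (sum-map-comm (λ κs i → term i κs) (kindWords n) (upTo n)) ⟩
  n * sum (map (λ i → sum (map (term i) (kindWords n))) (upTo n))
    ≡⟨ cong (n *_) (sum-map-cong (upTo n) (λ i _ → sym (*-distribʳ-sum (p ^ (n ∸ i)) (forestIndicator₂ 1 i (n ∸ 1 ∸ i)) (kindWords n)))) ⟩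
  n * sum (map (λ i → forestCount₂ 1 n i (n ∸ 1 ∸ i) * p ^ (n ∸ i)) (upTo n))
    ≡⟨ *-distribˡ-sum n (λ i → forestCount₂ 1 n i (n ∸ 1 ∸ i) * p ^ (n ∸ i)) (upTo n) ⟩
  sum (map (λ i → n * (forestCount₂ 1 n i (n ∸ 1 ∸ i) * p ^ (n ∸ i))) (upTo n))
    ≡⟨ sum-map-cong (upTo n) (λ i i∈ → summand i (∈-upTo⁻ i∈)) ⟩
  sum (map (λ i → (n C i) * ((2 * n) C (n ∸ 1 ∸ i)) * p ^ (n ∸ i)) (upTo n)) ∎
  where
  open ≡-Reasoning
  term : ℕ → List Kind → ℕ
  term i κs = forestIndicator₂ 1 i (n ∸ 1 ∸ i) κs * p ^ (n ∸ i)
  summand : ∀ i → i < n → n * (forestCount₂ 1 n i (n ∸ 1 ∸ i) * p ^ (n ∸ i)) ≡ (n C i) * ((2 * n) C (n ∸ 1 ∸ i)) * p ^ (n ∸ i)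
  summand i i<n = trans (sym (*-assoc n _ _)) (cong (_* p ^ (n ∸ i))
    (trans (forestFormula₂ n 1 i (n ∸ 1 ∸ i) (1+i+[n∸1∸i]≡n i<n))
      (trans (*-identityˡ _) (cong₂ _*_ (binom≡C n i)
        (trans (cong (λ k → binom k (n ∸ 1 ∸ i)) (double≡2* n)) (binom≡C (2 * n) (n ∸ 1 ∸ i)))))))

-- Symmetry

monomial : ℕ → ℕ → ℕ → ℕ → ℕ → ℕ → ℕ
monomial a b c p q r = p ^ (1 + a + c) * q ^ (1 + a + b) * r ^ (1 + b + c)

treeMonomial : ℕ → ℕ → ℕ → Tree → ℕ
treeMonomial p q r t = monomial (lefts (preorder t)) (middles (preorder t)) (rights (preorder t)) p q r

tree-size : ∀ t → nonempty t ≡ true → 1 + lefts (preorder t) + middles (preorder t) + rights (preorder t) ≡ size t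
tree-size t t≢leaf = trans (isForest-length 1 (preorder t) (isForest-1-preorder t t≢leaf)) (length-preorder t)

-- The factor q r turns all three exponents into 1 + (a sum of two of the counts a, b, c).
qr-C213≡treeMonomials : ∀ n → 1 ≤ n → ∀ p q r → q * r * C213 n p q r ≡ sum (map (treeMonomial p q r) (trees n))
qr-C213≡treeMonomials n 1≤n p q r =
  trans (cong (q * r *_) (sum-Q213 n _)) (trans (*-distribˡ-sum (q * r) _ (trees n)) (sum-map-cong (trees n) per-tree))
  where
  per-tree : ∀ t → t ∈ trees n →
    q * r * (p ^ plat (flatten 0 t) * q ^ des (flatten 0 t) * r ^ asc (flatten 0 t)) ≡ treeMonomial p q r t
  per-tree t t∈ = trans (cong₃ (λ x y z → q * r * (p ^ x * q ^ y * r ^ z)) plat≡ (des-flatten 0 t) (asc-flatten 0 t))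
                        (absorb-qr q r (p ^ (1 + a + c)) (q ^ (a + b)) (r ^ (b + c)))
    where
    a = lefts (preorder t)
    b = middles (preorder t)
    c = rights (preorder t)
    absorb-qr : ∀ q r P Q R → q * r * (P * Q * R) ≡ P * (q * Q) * (r * R)
    absorb-qr = solve-∀
    size≡ : 1 + a + b + c ≡ size t
    size≡ = tree-size t (nonempty-size t (subst (1 ≤_) (sym (∈-trees⁻ {n} t∈)) 1≤n))
    plat≡ : plat (flatten 0 t) ≡ 1 + a + c
    plat≡ = +-cancelʳ-≡ b _ _ (trans (plat-flatten 0 t) (trans (sym size≡) (swap-b a b c)))
      where
      swap-b : ∀ a b c → 1 + a + b + c ≡ 1 + a + c + b
      swap-b = solve-∀

swapMiddleRight swapOuter : Tree → Tree
swapMiddleRight leaf         = leaf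
swapMiddleRight (node L M R) = node (swapMiddleRight L) (swapMiddleRight R) (swapMiddleRight M)
swapOuter leaf         = leaf
swapOuter (node L M R) = node (swapOuter R) (swapOuter M) (swapOuter L)

swapMiddleRight-involutive : ∀ t → swapMiddleRight (swapMiddleRight t) ≡ t
swapMiddleRight-involutive leaf         = refl
swapMiddleRight-involutive (node L M R) =
  cong₃ node (swapMiddleRight-involutive L) (swapMiddleRight-involutive M) (swapMiddleRight-involutive R)

swapOuter-involutive : ∀ t → swapOuter (swapOuter t) ≡ t
swapOuter-involutive leaf         = refl
swapOuter-involutive (node L M R) = cong₃ node (swapOuter-involutive L) (swapOuter-involutive M) (swapOuter-involutive R)

size-swapMiddleRight : ∀ t → size (swapMiddleRight t) ≡ size t
size-swapMiddleRight leaf         = refl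
size-swapMiddleRight (node L M R) =
  cong suc (trans (cong₃ (λ l m r → l + r + m) (size-swapMiddleRight L) (size-swapMiddleRight M) (size-swapMiddleRight R))
                  (regroup (size L) (size M) (size R)))
  where
  regroup : ∀ l m r → l + r + m ≡ l + m + r
  regroup = solve-∀

size-swapOuter : ∀ t → size (swapOuter t) ≡ size t
size-swapOuter leaf         = refl
size-swapOuter (node L M R) =
  cong suc (trans (cong₃ (λ l m r → r + m + l) (size-swapOuter L) (size-swapOuter M) (size-swapOuter R)) (regroup (size L) (size M) (size R)))
  where
  regroup : ∀ l m r → r + m + l ≡ l + m + r
  regroup = solve-∀

sum-trees-involution : ∀ (sw : Tree → Tree) → (∀ t → sw (sw t) ≡ t) → (∀ t → size (sw t) ≡ size t) →
  ∀ n (h : Tree → ℕ) → sum (map (λ t → h (sw t)) (trees n)) ≡ sum (map h (trees n))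
sum-trees-involution sw involutive size-sw n h = trans (sym (sum-map-map h sw (trees n))) (sum-map-↭ h map-sw↭)
  where
  sw-trees : ∀ {t} → t ∈ trees n → sw t ∈ trees n
  sw-trees {t} t∈ = subst (λ k → sw t ∈ trees k) (trans (size-sw t) (∈-trees⁻ {n} t∈)) (∈-trees⁺ (sw t))
  map-sw↭ : map sw (trees n) ↭ trees n
  map-sw↭ = unique-⇔⇒↭ (Unique.map⁺ (λ {t} {t′} eq → trans (sym (involutive t)) (trans (cong sw eq) (involutive t′))) (trees-unique n))
    (trees-unique n) (λ t∈ → case-map t∈) (λ {t} t∈ → subst (_∈ map sw (trees n)) (involutive t) (∈-map⁺ sw (sw-trees t∈)))
    where
    case-map : ∀ {t} → t ∈ map sw (trees n) → t ∈ trees n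
    case-map t∈ with ∈-map⁻ sw t∈
    ... | _ , t′∈ , refl = sw-trees t′∈

nonempty-swapMiddleRight : ∀ t → nonempty (swapMiddleRight t) ≡ nonempty t
nonempty-swapMiddleRight leaf         = refl
nonempty-swapMiddleRight (node _ _ _) = refl

nonempty-swapOuter : ∀ t → nonempty (swapOuter t) ≡ nonempty t
nonempty-swapOuter leaf         = refl
nonempty-swapOuter (node _ _ _) = refl

swapKindMiddleRight swapKindOuter : Kind → Kind
swapKindMiddleRight (kind i j l) = kind i l j
swapKindOuter       (kind i j l) = kind l j i

sum-map-preorder-swapMiddleRight : ∀ (f : Kind → ℕ) t →
  sum (map f (preorder (swapMiddleRight t))) ≡ sum (map (λ κ → f (swapKindMiddleRight κ)) (preorder t))
sum-map-preorder-swapMiddleRight f leaf         = refl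
sum-map-preorder-swapMiddleRight f (node L M R) = begin
  sum (map f (preorder (node (swapMiddleRight L) (swapMiddleRight R) (swapMiddleRight M))))
    ≡⟨ sum-map-preorder f (swapMiddleRight L) (swapMiddleRight R) (swapMiddleRight M) ⟩
  f (kind (nonempty (swapMiddleRight L)) (nonempty (swapMiddleRight R)) (nonempty (swapMiddleRight M)))
    + (sum (map f (preorder (swapMiddleRight L))) + (sum (map f (preorder (swapMiddleRight R))) + sum (map f (preorder (swapMiddleRight M)))))
    ≡⟨ cong₂ _+_ (cong₃ (λ i j l → f (kind i j l)) (nonempty-swapMiddleRight L) (nonempty-swapMiddleRight R) (nonempty-swapMiddleRight M))
                 (cong₃ (λ x y z → x + (y + z)) (sum-map-preorder-swapMiddleRight f L) (sum-map-preorder-swapMiddleRight f R)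
                                                 (sum-map-preorder-swapMiddleRight f M)) ⟩
  f (kind (nonempty L) (nonempty R) (nonempty M)) + (weigh L + (weigh R + weigh M))
    ≡⟨ cong (f (kind (nonempty L) (nonempty R) (nonempty M)) +_) (cong (weigh L +_) (+-comm (weigh R) (weigh M))) ⟩
  f (kind (nonempty L) (nonempty R) (nonempty M)) + (weigh L + (weigh M + weigh R))
    ≡⟨ sum-map-preorder (λ κ → f (swapKindMiddleRight κ)) L M R ⟨
  sum (map (λ κ → f (swapKindMiddleRight κ)) (preorder (node L M R))) ∎
  where
  open ≡-Reasoning
  weigh : Tree → ℕ
  weigh t = sum (map (λ κ → f (swapKindMiddleRight κ)) (preorder t))

sum-map-preorder-swapOuter : ∀ (f : Kind → ℕ) t →
  sum (map f (preorder (swapOuter t))) ≡ sum (map (λ κ → f (swapKindOuter κ)) (preorder t))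
sum-map-preorder-swapOuter f leaf         = refl
sum-map-preorder-swapOuter f (node L M R) = begin
  sum (map f (preorder (node (swapOuter R) (swapOuter M) (swapOuter L))))
    ≡⟨ sum-map-preorder f (swapOuter R) (swapOuter M) (swapOuter L) ⟩
  f (kind (nonempty (swapOuter R)) (nonempty (swapOuter M)) (nonempty (swapOuter L)))
    + (sum (map f (preorder (swapOuter R))) + (sum (map f (preorder (swapOuter M))) + sum (map f (preorder (swapOuter L)))))
    ≡⟨ cong₂ _+_ (cong₃ (λ i j l → f (kind i j l)) (nonempty-swapOuter R) (nonempty-swapOuter M) (nonempty-swapOuter L))
                 (cong₃ (λ x y z → x + (y + z)) (sum-map-preorder-swapOuter f R) (sum-map-preorder-swapOuter f M)
                                                 (sum-map-preorder-swapOuter f L)) ⟩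
  f (kind (nonempty R) (nonempty M) (nonempty L)) + (weigh R + (weigh M + weigh L))
    ≡⟨ cong (f (kind (nonempty R) (nonempty M) (nonempty L)) +_) (reverse3 (weigh R) (weigh M) (weigh L)) ⟩
  f (kind (nonempty R) (nonempty M) (nonempty L)) + (weigh L + (weigh M + weigh R))
    ≡⟨ sum-map-preorder (λ κ → f (swapKindOuter κ)) L M R ⟨
  sum (map (λ κ → f (swapKindOuter κ)) (preorder (node L M R))) ∎
  where
  open ≡-Reasoning
  weigh : Tree → ℕ
  weigh t = sum (map (λ κ → f (swapKindOuter κ)) (preorder t))
  reverse3 : ∀ x y z → x + (y + z) ≡ z + (y + x)
  reverse3 = solve-∀

treeMonomial-swapMiddleRight : ∀ p q r t → treeMonomial p q r (swapMiddleRight t) ≡ treeMonomial q p r t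
treeMonomial-swapMiddleRight p q r t =
  trans (cong₃ (λ a b c → monomial a b c p q r)
          (trans (sum-map-preorder-swapMiddleRight hasLeft t) (sum-map-cong (preorder t) (λ { (kind i j l) _ → refl })))
          (trans (sum-map-preorder-swapMiddleRight hasMiddle t) (sum-map-cong (preorder t) (λ { (kind i j l) _ → refl })))
          (trans (sum-map-preorder-swapMiddleRight hasRight t) (sum-map-cong (preorder t) (λ { (kind i j l) _ → refl }))))
        (swap-pq (p ^ (1 + a + b)) (q ^ (1 + a + c)) (cong (r ^_) (cong suc (+-comm c b))))
  where
  a = lefts (preorder t)
  b = middles (preorder t)
  c = rights (preorder t)
  swap-pq : ∀ P Q {R R′} → R ≡ R′ → P * Q * R ≡ Q * P * R′
  swap-pq P Q {R} refl = cong (_* R) (*-comm P Q)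

treeMonomial-swapOuter : ∀ p q r t → treeMonomial p q r (swapOuter t) ≡ treeMonomial p r q t
treeMonomial-swapOuter p q r t =
  trans (cong₃ (λ a b c → monomial a b c p q r)
          (trans (sum-map-preorder-swapOuter hasLeft t) (sum-map-cong (preorder t) (λ { (kind i j l) _ → refl })))
          (trans (sum-map-preorder-swapOuter hasMiddle t) (sum-map-cong (preorder t) (λ { (kind i j l) _ → refl })))
          (trans (sum-map-preorder-swapOuter hasRight t) (sum-map-cong (preorder t) (λ { (kind i j l) _ → refl }))))
        (swap-qr (cong (p ^_) (cong suc (+-comm c a))) (cong (q ^_) (cong suc (+-comm c b))) (cong (r ^_) (cong suc (+-comm b a))))
  where
  a = lefts (preorder t)
  b = middles (preorder t)
  c = rights (preorder t)
  swap-qr : ∀ {P P′ Q Q′ R R′} → P ≡ P′ → Q ≡ Q′ → R ≡ R′ → P * Q * R ≡ P′ * R′ * Q′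
  swap-qr {P} {_} {Q} {_} {R} refl refl refl = *-assoc-comm P Q R
    where
    *-assoc-comm : ∀ P Q R → P * Q * R ≡ P * R * Q
    *-assoc-comm = solve-∀

treeMonomials : ℕ → ℕ → ℕ → ℕ → ℕ
treeMonomials n p q r = sum (map (treeMonomial p q r) (trees n))

treeMonomials-swap₁₂ : ∀ n p q r → treeMonomials n p q r ≡ treeMonomials n q p r
treeMonomials-swap₁₂ n p q r =
  trans (sym (sum-trees-involution swapMiddleRight swapMiddleRight-involutive size-swapMiddleRight n (treeMonomial p q r)))
        (sum-map-cong (trees n) (λ t _ → treeMonomial-swapMiddleRight p q r t))

treeMonomials-swap₂₃ : ∀ n p q r → treeMonomials n p q r ≡ treeMonomials n p r q
treeMonomials-swap₂₃ n p q r =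
  trans (sym (sum-trees-involution swapOuter swapOuter-involutive size-swapOuter n (treeMonomial p q r)))
        (sum-map-cong (trees n) (λ t _ → treeMonomial-swapOuter p q r t))

symmetric3 : ∀ (f : ℕ → ℕ → ℕ → ℕ) → (∀ x y z → f x y z ≡ f y x z) → (∀ x y z → f x y z ≡ f x z y) → Symmetric3 f
symmetric3 f swap₁₂ swap₂₃ x y z =
  swap₁₂ x y z ,
  swap₂₃ x y z ,
  trans (swap₁₂ x y z) (trans (swap₂₃ y x z) (swap₁₂ y z x)) ,
  trans (swap₁₂ x y z) (swap₂₃ y x z) ,
  trans (swap₂₃ x y z) (swap₁₂ x z y)

qr-C213-symmetric : ∀ n → 1 ≤ n → Symmetric3 (λ p q r → q * r * C213 n p q r)
qr-C213-symmetric n 1≤n = symmetric3 _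
  (λ x y z → via-trees x y z y x z (treeMonomials-swap₁₂ n x y z))
  (λ x y z → via-trees x y z x z y (treeMonomials-swap₂₃ n x y z))
  where
  via-trees : ∀ p q r p′ q′ r′ → treeMonomials n p q r ≡ treeMonomials n p′ q′ r′ → q * r * C213 n p q r ≡ q′ * r′ * C213 n p′ q′ r′
  via-trees p q r p′ q′ r′ eq =
    trans (qr-C213≡treeMonomials n 1≤n p q r) (trans eq (sym (qr-C213≡treeMonomials n 1≤n p′ q′ r′)))

theorem1p1 : ∀ (n : ℕ) → 1 ≤ n →
    Symmetric3 (λ p q r → q * r * C213 n p q r)
    × (∀ (m d k : ℕ) →
        (2 * n ∸ 1 ≡ m + d + k → n * N213 n m d k ≡ (n C (m + 1)) * (n C (d + 1)) * (n C k))
        × (¬ (2 * n ∸ 1 ≡ m + d + k) → N213 n m d k ≡ 0))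
    × (∀ (p : ℕ) →
        n * sum (map (λ σ → p ^ plat σ) (Q213 n))
          ≡ sum (map (λ i → (n C i) * ((2 * n) C (n ∸ 1 ∸ i)) * p ^ (n ∸ i)) (upTo n)))
theorem1p1 n 1≤n =
  qr-C213-symmetric n 1≤n ,
  (λ m d k → N213-diagonal n 1≤n m d k , N213-off-diagonal n 1≤n m d k) ,
  plateau-formula n 1≤n
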